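{- Let $r\in\mathbb{N}$ and suppose $\rho\in[\frac{r-1}{r},\frac{r}{r+1}]$. Then \[\tau(\rho)\le\begin{cases}\frac{(r-1)(r-2)}{r^2}+\frac{3(r-1)}{r}\left(\rho-\frac{r-1}{r}\right) & \text{if } \frac{r-1}{r}\le\rho\le\frac{r}{r+1}-\frac{1}{3r(r+1)},\\[4pt] \frac{r(r-1)}{(r+1)^2}-\frac{3(r-1)}{r+1}\left(\frac{r}{r+1}-\rho\right) & \text{if } \frac{r}{r+1}-\frac{1}{3r(r+1)}\le \rho\le\frac{r}{r+1}.\end{cases}\]
   Context: For a graph $G$ on $n$ vertices, its edge density is $\rho(G)=e(G)/\binom{n}{2}$; the triangle-degree of a vertex $x$ is the number of triangles of $G$ containing $x$, and $t_{\max}(G)$ is the maximum triangle-degree over all vertices of $G$. For $\rho\in[0,1]$, \[\tau(\rho)=\liminf_{n\to\infty}\min\left\{t_{\max}(G)/\tbinom{n-1}{2}:\ v(G)=n,\ \rho(G)\ge\rho\right\}.\]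
   Formalization: The edge density ρ ranges over the rationals rather than over the reals. -}

module Defs where

open import Data.Bool using (Bool; true; false; _∧_; if_then_else_)
open import Data.Nat as ℕ using (ℕ; zero; suc; _∸_; _⊔_; _<ᵇ_; NonZero)
open import Data.Nat.Combinatorics using (_C_)
open import Data.Fin using (Fin; toℕ)
open import Data.List using (List; map; foldr; allFin)
open import Data.Nat.ListAction using (sum)
import Data.Nat.Properties as ℕP
open import Data.Integer as ℤ using (ℤ; +_)
open import Data.Rational as ℚ using (ℚ; _/_; _+_; _-_; _*_; _≤_; _<_)
open import Data.Product using (Σ; _×_; ∃-syntax)
open import Relation.Binary.PropositionalEquality using (_≡_)

record Graph (n : ℕ) : Set where
  field
    adj      : Fin n → Fin n → Bool
    sym      : ∀ i j → adj i j ≡ adj j i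
    loopless : ∀ i → adj i i ≡ false
open Graph public

private
  countPairs : (n : ℕ) → (Fin n → Fin n → Bool) → ℕ
  countPairs n P =
    sum (map (λ i → sum (map (λ j →
           if (toℕ i <ᵇ toℕ j) ∧ P i j then 1 else 0) (allFin n))) (allFin n))

edges : ∀ {n} → Graph n → ℕ
edges {n} G = countPairs n (adj G)

triDeg : ∀ {n} → Graph n → Fin n → ℕ
triDeg {n} G x = countPairs n (λ j k → adj G x j ∧ adj G x k ∧ adj G j k)

tmax : ∀ {n} → Graph n → ℕ
tmax {n} G = foldr _⊔_ 0 (map (triDeg G) (allFin n))

ℕtoℚ : ℕ → ℚ
ℕtoℚ m = + m / 1

-- "τ(ρ) ≤ c", unfolding the liminf:
-- for every ε > 0 and every N there is n ≥ N and a graph G on n vertices with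
-- ρ(G) = e(G)/C(n,2) ≥ ρ and t_max(G)/C(n-1,2) ≤ c + ε.
-- (Both ratios are written in cleared-denominator form; denominators are
-- positive for n ≥ 3, and small n are irrelevant since N is arbitrary.)
TauLe : ℚ → ℚ → Set
TauLe ρ c =
  ∀ (ε : ℚ) → ℚ.0ℚ < ε → ∀ (N : ℕ) →
    ∃[ n ] (N ℕ.≤ n × Σ (Graph n) λ G →
      (ρ * ℕtoℚ (n C 2) ≤ ℕtoℚ (edges G)) ×
      (ℕtoℚ (tmax G) ≤ (c + ε) * ℕtoℚ ((n ∸ 1) C 2)))

lowerEnd : (r : ℕ) → .{{NonZero r}} → ℚ
lowerEnd r = + (r ∸ 1) / r

upperEnd : (r : ℕ) → ℚ
upperEnd r = + r / suc r

breakPt : (r : ℕ) → .{{NonZero r}} → ℚ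
breakPt r = upperEnd r - (+ 1 / (3 ℕ.* r ℕ.* suc r)) {{ℕP.m*n≢0 (3 ℕ.* r) (suc r) {{ℕP.m*n≢0 3 r}}}}

bound₁ : (r : ℕ) → .{{NonZero r}} → ℚ → ℚ
bound₁ r ρ =
  ((+ (r ∸ 1) ℤ.* (+ r ℤ.- + 2)) / (r ℕ.* r)) {{ℕP.m*n≢0 r r}}
  + (+ (3 ℕ.* (r ∸ 1)) / r) * (ρ - lowerEnd r)

bound₂ : (r : ℕ) → ℚ → ℚ
bound₂ r ρ =
  (+ (r ℕ.* (r ∸ 1)) / (suc r ℕ.* suc r))
  - (+ (3 ℕ.* (r ∸ 1)) / suc r) * (upperEnd r - ρ)

module Submission where

-- Up to the rounding of n²/2 to C(n-1,2), τ(ρ) ≤ c follows from regular graphs on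
-- arbitrarily many vertices n whose degree is exactly ρn and whose triangle-degrees are at most
-- cn²/2.  The graphs are complete joins of blow-ups in which two classes of h vertices are joined
-- completely, not at all, or by the e-regular bipartite circulant u ∼ v ⇔ (u + v) mod h < e.
-- For bound₁ join r copies of this bipartite graph, with e chosen so that the density is ρ.  For
-- bound₂ take r + 1 parts matched in pairs by such sparse bipartite graphs; when r is even, three
-- of the parts form a hexagonal gadget, whose sparse degree is nonnegative once ρ ≥ breakPt r.

module Counting where

  open import Data.Bool using (Bool; true; false; _∧_; if_then_else_)
  open import Data.Bool.Properties using (∧-comm; ∧-assoc; ∧-zeroʳ; ∧-identityʳ)
  open import Data.Nat using (ℕ; zero; suc; _+_; _*_; _∸_; _⊔_; _≡ᵇ_; _≤_; _<_; _<ᵇ_; z≤n; s≤s; NonZero)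
  open import Data.Nat.Properties
  open import Data.Nat.DivMod using (_/_; _%_; m≡m%n+[m/n]*n; m%n<n; [m+n]%n≡m%n; [m+kn]%n≡m%n; m<n⇒m%n≡m;
                                     +-distrib-/; m*n/n≡m; m*n%n≡0; m<n⇒m/n≡0; m<n*o⇒m/o<n)
  open import Data.Nat.Tactic.RingSolver using (solve-∀)
  open import Algebra.Properties.CommutativeSemigroup +-commutativeSemigroup using (interchange; x∙yz≈y∙xz)
  open import Data.Fin using (Fin; toℕ; fromℕ<)
  open import Data.Fin.Properties using (all?; toℕ-fromℕ<)
  open import Data.List using ([]; _∷_; map; foldr; allFin; tabulate)
  open import Data.List.Properties using (map-cong; map-tabulate)
  open import Data.Nat.ListAction using (sum)
  open import Data.Product using (∃-syntax; _×_; _,_; proj₁; proj₂)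
  open import Data.Sum using (_⊎_; inj₁; inj₂)
  open import Function using (id; _∘_)
  open import Relation.Nullary.Decidable using (True; toWitness)
  open import Relation.Binary.PropositionalEquality
  open import Defs using (Graph; edges; triDeg; tmax)

  𝟙 : Bool → ℕ
  𝟙 b = if b then 1 else 0

  𝟙-∧ˡ : ∀ a b → 𝟙 (a ∧ b) ≤ 𝟙 a
  𝟙-∧ˡ false b     = z≤n
  𝟙-∧ˡ true  false = z≤n
  𝟙-∧ˡ true  true  = ≤-refl

  𝟙-∧ʳ : ∀ a b → 𝟙 (a ∧ b) ≤ 𝟙 b
  𝟙-∧ʳ false b = z≤n
  𝟙-∧ʳ true  b = ≤-refl

  ∑ : ℕ → (ℕ → ℕ) → ℕ
  ∑ zero    f = 0
  ∑ (suc n) f = f 0 + ∑ n (λ i → f (suc i))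

  syntax ∑ n (λ i → e) = ∑[ i < n ] e

  ∑-cong : ∀ n {f g : ℕ → ℕ} → (∀ i → i < n → f i ≡ g i) → ∑ n f ≡ ∑ n g
  ∑-cong zero    eq = refl
  ∑-cong (suc n) eq = cong₂ _+_ (eq 0 (s≤s z≤n)) (∑-cong n (λ i i<n → eq (suc i) (s≤s i<n)))

  ∑-mono-≤ : ∀ n {f g : ℕ → ℕ} → (∀ i → i < n → f i ≤ g i) → ∑ n f ≤ ∑ n g
  ∑-mono-≤ zero    le = z≤n
  ∑-mono-≤ (suc n) le = +-mono-≤ (le 0 (s≤s z≤n)) (∑-mono-≤ n (λ i i<n → le (suc i) (s≤s i<n)))

  ∑-const : ∀ n c → ∑[ _ < n ] c ≡ n * c
  ∑-const zero    c = refl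
  ∑-const (suc n) c = cong (c +_) (∑-const n c)

  ∑-zero : ∀ n {f} → (∀ i → i < n → f i ≡ 0) → ∑ n f ≡ 0
  ∑-zero n eq = trans (∑-cong n eq) (trans (∑-const n 0) (*-zeroʳ n))

  ∑-split : ∀ m n f → ∑ (m + n) f ≡ ∑ m f + ∑[ i < n ] f (m + i)
  ∑-split zero    n f = refl
  ∑-split (suc m) n f = trans (cong (f 0 +_) (∑-split m n (λ i → f (suc i)))) (sym (+-assoc (f 0) _ _))

  ∑-snoc : ∀ n f → ∑ (suc n) f ≡ ∑ n f + f n
  ∑-snoc zero    f = +-identityʳ (f 0)
  ∑-snoc (suc n) f = trans (cong (f 0 +_) (∑-snoc n (λ i → f (suc i)))) (sym (+-assoc (f 0) _ _))

  ∑-distrib-+ : ∀ n f g → ∑[ i < n ] (f i + g i) ≡ ∑ n f + ∑ n g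
  ∑-distrib-+ zero    f g = refl
  ∑-distrib-+ (suc n) f g =
    trans (cong (f 0 + g 0 +_) (∑-distrib-+ n (λ i → f (suc i)) (λ i → g (suc i)))) (interchange (f 0) (g 0) _ _)

  *-distribˡ-∑ : ∀ n c f → c * ∑ n f ≡ ∑[ i < n ] (c * f i)
  *-distribˡ-∑ zero    c f = *-zeroʳ c
  *-distribˡ-∑ (suc n) c f = trans (*-distribˡ-+ c (f 0) _) (cong (c * f 0 +_) (*-distribˡ-∑ n c (λ i → f (suc i))))

  *-distribʳ-∑ : ∀ n c g → ∑ n g * c ≡ ∑[ i < n ] (g i * c)
  *-distribʳ-∑ n c g = trans (*-comm (∑ n g) c) (trans (*-distribˡ-∑ n c g) (∑-cong n (λ i _ → *-comm c (g i))))

  ∑-comm : ∀ m n (f : ℕ → ℕ → ℕ) → ∑[ i < m ] ∑[ j < n ] f i j ≡ ∑[ j < n ] ∑[ i < m ] f i j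
  ∑-comm zero    n f = sym (∑-zero n (λ _ _ → refl))
  ∑-comm (suc m) n f = trans (cong (∑[ j < n ] f 0 j +_) (∑-comm m n (λ i → f (suc i))))
                             (sym (∑-distrib-+ n (f 0) (λ j → ∑[ i < m ] f (suc i) j)))

  ∑∑-split : ∀ m n f → ∑[ i < m + n ] ∑[ j < m + n ] f i j ≡
    (∑[ i < m ] ∑[ j < m ] f i j + ∑[ i < m ] ∑[ j < n ] f i (m + j)) +
    (∑[ i < n ] ∑[ j < m ] f (m + i) j + ∑[ i < n ] ∑[ j < n ] f (m + i) (m + j))
  ∑∑-split m n f = trans (∑-split m n _) (cong₂ _+_ (rows m f) (rows n (λ i → f (m + i))))
    where
    rows : ∀ k (g : ℕ → ℕ → ℕ) →
      ∑[ i < k ] ∑[ j < m + n ] g i j ≡ ∑[ i < k ] ∑[ j < m ] g i j + ∑[ i < k ] ∑[ j < n ] g i (m + j)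
    rows k g = trans (∑-cong k (λ i _ → ∑-split m n (g i))) (∑-distrib-+ k _ _)

  ∑-blocks : ∀ K h f → ∑ (K * h) f ≡ ∑[ c < K ] ∑[ u < h ] f (c * h + u)
  ∑-blocks zero    h f = refl
  ∑-blocks (suc K) h f = trans (∑-split h (K * h) f) (cong (∑ h f +_) (trans (∑-blocks K h (λ x → f (h + x)))
    (∑-cong K (λ c _ → ∑-cong h (λ u _ → cong f (sym (+-assoc h (c * h) u)))))))

  ∑-periodic : ∀ h (g : ℕ → ℕ) → (∀ x → g (x + h) ≡ g x) → ∀ u → ∑[ v < h ] g (u + v) ≡ ∑ h g
  ∑-periodic h g per zero    = refl
  ∑-periodic h g per (suc u) = +-cancelʳ-≡ (g u) _ _ (begin
    ∑[ v < h ] g (suc u + v) + g u         ≡⟨ +-comm _ (g u) ⟩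
    g u + ∑[ v < h ] g (suc u + v)         ≡⟨ cong₂ _+_ (cong g (sym (+-identityʳ u)))
                                                         (∑-cong h (λ v _ → cong g (sym (+-suc u v)))) ⟩
    ∑[ v < suc h ] g (u + v)               ≡⟨ ∑-snoc h (λ v → g (u + v)) ⟩
    ∑[ v < h ] g (u + v) + g (u + h)       ≡⟨ cong₂ _+_ (∑-periodic h g per u) (per u) ⟩
    ∑ h g + g u                            ∎)
    where open ≡-Reasoning

  ∑-<ᵇ : ∀ n e → e ≤ n → ∑[ v < n ] 𝟙 (v <ᵇ e) ≡ e
  ∑-<ᵇ n       zero    _         = ∑-zero n (λ _ _ → refl)
  ∑-<ᵇ (suc n) (suc e) (s≤s e≤n) = cong suc (∑-<ᵇ n e e≤n)

  double-∑-pairs : ∀ n (P : ℕ → ℕ → Bool) → (∀ i j → P i j ≡ P j i) → (∀ i → P i i ≡ false) →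
    2 * ∑[ i < n ] ∑[ j < n ] 𝟙 ((i <ᵇ j) ∧ P i j) ≡ ∑[ i < n ] ∑[ j < n ] 𝟙 (P i j)
  double-∑-pairs zero    P P-sym irr = refl
  double-∑-pairs (suc n) P P-sym irr = begin
    2 * (A + L)
      ≡⟨ *-distribˡ-+ 2 A L ⟩
    2 * A + 2 * L
      ≡⟨ cong (2 * A +_) (double-∑-pairs n P′ (λ i j → P-sym (suc i) (suc j)) (irr ∘ suc)) ⟩
    2 * A + R
      ≡⟨ double A R ⟩
    A + (A + R)
      ≡⟨ cong₂ (λ b c → 𝟙 b + A + (c + R)) (irr 0) (∑-cong n (λ i _ → cong 𝟙 (P-sym (suc i) 0))) ⟨
    𝟙 (P 0 0) + A + (∑[ i < n ] 𝟙 (P (suc i) 0) + R)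
      ≡⟨ cong (𝟙 (P 0 0) + A +_) (∑-distrib-+ n _ _) ⟨
    𝟙 (P 0 0) + A + ∑[ i < n ] (𝟙 (P (suc i) 0) + ∑[ j < n ] 𝟙 (P′ i j)) ∎
    where
    open ≡-Reasoning
    P′ : ℕ → ℕ → Bool
    P′ i j = P (suc i) (suc j)
    A = ∑[ j < n ] 𝟙 (P 0 (suc j))
    L = ∑[ i < n ] ∑[ j < n ] 𝟙 ((i <ᵇ j) ∧ P′ i j)
    R = ∑[ i < n ] ∑[ j < n ] 𝟙 (P′ i j)
    double : ∀ a r → 2 * a + r ≡ a + (a + r)
    double a r = trans (cong (λ x → a + x + r) (+-identityʳ a)) (+-assoc a a r)

  -- Graphs on {0, …, n - 1}

  -- Adjacency is total on ℕ; only the vertices below order count.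
  record Graphℕ : Set where
    field
      order      : ℕ
      adj        : ℕ → ℕ → Bool
      adj-sym    : ∀ i j → adj i j ≡ adj j i
      adj-irrefl : ∀ i → adj i i ≡ false
  open Graphℕ public

  degree : Graphℕ → ℕ → ℕ
  degree G x = ∑[ j < order G ] 𝟙 (adj G x j)

  -- Ordered pairs, i.e. twice Defs.triDeg; this avoids the j < k bookkeeping in all counts.
  ordTriDeg : Graphℕ → ℕ → ℕ
  ordTriDeg G x = ∑[ j < order G ] ∑[ k < order G ] 𝟙 (adj G x j ∧ adj G x k ∧ adj G j k)

  toGraph : (G : Graphℕ) → Graph (order G)
  toGraph G = record
    { adj      = λ i j → adj G (toℕ i) (toℕ j)
    ; sym      = λ i j → adj-sym G (toℕ i) (toℕ j)
    ; loopless = λ i → adj-irrefl G (toℕ i)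
    }

  sum-allFin : ∀ n {f : Fin n → ℕ} {g : ℕ → ℕ} → (∀ i → f i ≡ g (toℕ i)) → sum (map f (allFin n)) ≡ ∑ n g
  sum-allFin n {f} {g} f≗g = trans (cong sum (trans (map-cong f≗g (allFin n)) (map-tabulate id (g ∘ toℕ)))) (sum-tabulate n g)
    where
    sum-tabulate : ∀ n g → sum (tabulate {n = n} (g ∘ toℕ)) ≡ ∑ n g
    sum-tabulate zero    g = refl
    sum-tabulate (suc n) g = cong (g 0 +_) (sum-tabulate n (g ∘ suc))

  handshake : ∀ G → 2 * edges (toGraph G) ≡ ∑[ x < order G ] degree G x
  handshake G = trans (cong (2 *_) (sum-allFin n (λ i → sum-allFin n (λ j → refl))))
                      (double-∑-pairs n (adj G) (adj-sym G) (adj-irrefl G))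
    where n = order G

  triDeg-toGraph : ∀ G x → 2 * triDeg (toGraph G) x ≡ ordTriDeg G (toℕ x)
  triDeg-toGraph G x = trans (cong (2 *_) (sum-allFin n (λ j → sum-allFin n (λ k → refl))))
                             (double-∑-pairs n P P-sym P-irrefl)
    where
    n = order G
    A = adj G
    P : ℕ → ℕ → Bool
    P j k = A (toℕ x) j ∧ A (toℕ x) k ∧ A j k
    P-sym : ∀ j k → P j k ≡ P k j
    P-sym j k = begin
      A (toℕ x) j ∧ A (toℕ x) k ∧ A j k   ≡⟨ ∧-assoc (A (toℕ x) j) _ _ ⟨
      (A (toℕ x) j ∧ A (toℕ x) k) ∧ A j k ≡⟨ cong₂ _∧_ (∧-comm (A (toℕ x) j) _) (adj-sym G j k) ⟩
      (A (toℕ x) k ∧ A (toℕ x) j) ∧ A k j ≡⟨ ∧-assoc (A (toℕ x) k) _ _ ⟩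
      A (toℕ x) k ∧ A (toℕ x) j ∧ A k j   ∎
      where open ≡-Reasoning
    P-irrefl : ∀ j → P j j ≡ false
    P-irrefl j rewrite adj-irrefl G j | ∧-zeroʳ (A (toℕ x) j) = ∧-zeroʳ (A (toℕ x) j)

  tmax-≤ : ∀ {n} (G : Graph n) k B → (∀ x → k * triDeg G x ≤ B) → k * tmax G ≤ B
  tmax-≤ {n} G k B bound = go (allFin n)
    where
    go : ∀ xs → k * foldr _⊔_ 0 (map (triDeg G) xs) ≤ B
    go []       = ≤-trans (≤-reflexive (*-zeroʳ k)) z≤n
    go (x ∷ xs) = ≤-trans (≤-reflexive (*-distribˡ-⊔ k (triDeg G x) _)) (⊔-lub (bound x) (go xs))

  -- Complete joins

  _⊕_ : Graphℕ → Graphℕ → Graphℕ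
  G ⊕ H = record { order = n₁ + order H ; adj = A ; adj-sym = A-sym ; adj-irrefl = A-irrefl }
    where
    n₁ = order G
    A : ℕ → ℕ → Bool
    A i j = if i <ᵇ n₁ then (if j <ᵇ n₁ then adj G i j else true)
                        else (if j <ᵇ n₁ then true else adj H (i ∸ n₁) (j ∸ n₁))
    A-sym : ∀ i j → A i j ≡ A j i
    A-sym i j with i <ᵇ n₁ | j <ᵇ n₁
    ... | true  | true  = adj-sym G i j
    ... | true  | false = refl
    ... | false | true  = refl
    ... | false | false = adj-sym H _ _
    A-irrefl : ∀ i → A i i ≡ false
    A-irrefl i with i <ᵇ n₁
    ... | true  = adj-irrefl G i
    ... | false = adj-irrefl H _

  module _ (G H : Graphℕ) where
    private
      n₁ = order G
      n₂ = order H
      A = adj (G ⊕ H)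

      <ᵇ-true : ∀ {i n} → i < n → (i <ᵇ n) ≡ true
      <ᵇ-true {zero}  {suc n} _         = refl
      <ᵇ-true {suc i} {suc n} (s≤s i<n) = <ᵇ-true i<n

      +-<ᵇ-false : ∀ n i → (n + i <ᵇ n) ≡ false
      +-<ᵇ-false zero    i = refl
      +-<ᵇ-false (suc n) i = +-<ᵇ-false n i

      regroup : ∀ a b c → a + b + (b + c) ≡ a + 2 * b + c
      regroup = solve-∀

    ⊕-adj-ll : ∀ {i j} → i < n₁ → j < n₁ → A i j ≡ adj G i j
    ⊕-adj-ll i<n₁ j<n₁ rewrite <ᵇ-true i<n₁ | <ᵇ-true j<n₁ = refl

    ⊕-adj-lr : ∀ {i} j → i < n₁ → A i (n₁ + j) ≡ true
    ⊕-adj-lr j i<n₁ rewrite <ᵇ-true i<n₁ | +-<ᵇ-false n₁ j = refl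

    ⊕-adj-rl : ∀ i {j} → j < n₁ → A (n₁ + i) j ≡ true
    ⊕-adj-rl i j<n₁ rewrite <ᵇ-true j<n₁ | +-<ᵇ-false n₁ i = refl

    ⊕-adj-rr : ∀ i j → A (n₁ + i) (n₁ + j) ≡ adj H i j
    ⊕-adj-rr i j rewrite +-<ᵇ-false n₁ i | +-<ᵇ-false n₁ j | m+n∸m≡n n₁ i | m+n∸m≡n n₁ j = refl

    degree-⊕ˡ : ∀ {x} → x < n₁ → degree (G ⊕ H) x ≡ degree G x + n₂
    degree-⊕ˡ {x} x<n₁ = trans (∑-split n₁ n₂ _) (cong₂ _+_
      (∑-cong n₁ (λ j j<n₁ → cong 𝟙 (⊕-adj-ll x<n₁ j<n₁)))
      (trans (∑-cong n₂ (λ j _ → cong 𝟙 (⊕-adj-lr j x<n₁))) (trans (∑-const n₂ 1) (*-identityʳ n₂))))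

    degree-⊕ʳ : ∀ x → degree (G ⊕ H) (n₁ + x) ≡ n₁ + degree H x
    degree-⊕ʳ x = trans (∑-split n₁ n₂ _) (cong₂ _+_
      (trans (∑-cong n₁ (λ j j<n₁ → cong 𝟙 (⊕-adj-rl x j<n₁))) (trans (∑-const n₁ 1) (*-identityʳ n₁)))
      (∑-cong n₂ (λ j _ → cong 𝟙 (⊕-adj-rr x j))))

    ordTriDeg-⊕ˡ : ∀ {x} → x < n₁ →
      ordTriDeg (G ⊕ H) x ≡ ordTriDeg G x + 2 * (n₂ * degree G x) + ∑[ j < n₂ ] degree H j
    ordTriDeg-⊕ˡ {x} x<n₁ = begin
      ordTriDeg (G ⊕ H) x
        ≡⟨ ∑∑-split n₁ n₂ _ ⟩
      (∑[ j < n₁ ] ∑[ k < n₁ ] t j k + ∑[ j < n₁ ] ∑[ k < n₂ ] t j (n₁ + k)) +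
      (∑[ j < n₂ ] ∑[ k < n₁ ] t (n₁ + j) k + ∑[ j < n₂ ] ∑[ k < n₂ ] t (n₁ + j) (n₁ + k))
        ≡⟨ cong₂ _+_ (cong₂ _+_ GG GH) (cong₂ _+_ HG HH) ⟩
      ordTriDeg G x + n₂ * degree G x + (n₂ * degree G x + ∑[ j < n₂ ] degree H j)
        ≡⟨ regroup (ordTriDeg G x) (n₂ * degree G x) _ ⟩
      ordTriDeg G x + 2 * (n₂ * degree G x) + ∑[ j < n₂ ] degree H j ∎
      where
      open ≡-Reasoning
      t : ℕ → ℕ → ℕ
      t j k = 𝟙 (A x j ∧ A x k ∧ A j k)
      GG : ∑[ j < n₁ ] ∑[ k < n₁ ] t j k ≡ ordTriDeg G x
      GG = ∑-cong n₁ λ j j<n₁ → ∑-cong n₁ λ k k<n₁ →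
        cong₂ (λ a b → 𝟙 (a ∧ b)) (⊕-adj-ll x<n₁ j<n₁) (cong₂ _∧_ (⊕-adj-ll x<n₁ k<n₁) (⊕-adj-ll j<n₁ k<n₁))
      GH : ∑[ j < n₁ ] ∑[ k < n₂ ] t j (n₁ + k) ≡ n₂ * degree G x
      GH = trans (∑-cong n₁ λ j j<n₁ → trans (∑-cong n₂ λ k _ → trans
             (cong₂ (λ a b → 𝟙 (a ∧ b)) (⊕-adj-ll x<n₁ j<n₁) (cong₂ _∧_ (⊕-adj-lr k x<n₁) (⊕-adj-lr k j<n₁)))
             (cong 𝟙 (∧-identityʳ _))) (∑-const n₂ _))
           (sym (*-distribˡ-∑ n₁ n₂ _))
      HG : ∑[ j < n₂ ] ∑[ k < n₁ ] t (n₁ + j) k ≡ n₂ * degree G x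
      HG = trans (∑-cong n₂ λ j _ → ∑-cong n₁ λ k k<n₁ → trans
             (cong₂ (λ a b → 𝟙 (a ∧ b)) (⊕-adj-lr j x<n₁) (cong₂ _∧_ (⊕-adj-ll x<n₁ k<n₁) (⊕-adj-rl j k<n₁)))
             (cong 𝟙 (∧-identityʳ _)))
           (∑-const n₂ _)
      HH : ∑[ j < n₂ ] ∑[ k < n₂ ] t (n₁ + j) (n₁ + k) ≡ ∑[ j < n₂ ] degree H j
      HH = ∑-cong n₂ λ j _ → ∑-cong n₂ λ k _ →
        cong₂ (λ a b → 𝟙 (a ∧ b)) (⊕-adj-lr j x<n₁) (cong₂ _∧_ (⊕-adj-lr k x<n₁) (⊕-adj-rr j k))

    ordTriDeg-⊕ʳ : ∀ x →
      ordTriDeg (G ⊕ H) (n₁ + x) ≡ ∑[ j < n₁ ] degree G j + 2 * (n₁ * degree H x) + ordTriDeg H x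
    ordTriDeg-⊕ʳ x = begin
      ordTriDeg (G ⊕ H) (n₁ + x)
        ≡⟨ ∑∑-split n₁ n₂ _ ⟩
      (∑[ j < n₁ ] ∑[ k < n₁ ] t j k + ∑[ j < n₁ ] ∑[ k < n₂ ] t j (n₁ + k)) +
      (∑[ j < n₂ ] ∑[ k < n₁ ] t (n₁ + j) k + ∑[ j < n₂ ] ∑[ k < n₂ ] t (n₁ + j) (n₁ + k))
        ≡⟨ cong₂ _+_ (cong₂ _+_ GG GH) (cong₂ _+_ HG HH) ⟩
      ∑[ j < n₁ ] degree G j + n₁ * degree H x + (n₁ * degree H x + ordTriDeg H x)
        ≡⟨ regroup (∑[ j < n₁ ] degree G j) (n₁ * degree H x) _ ⟩
      ∑[ j < n₁ ] degree G j + 2 * (n₁ * degree H x) + ordTriDeg H x ∎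
      where
      open ≡-Reasoning
      t : ℕ → ℕ → ℕ
      t j k = 𝟙 (A (n₁ + x) j ∧ A (n₁ + x) k ∧ A j k)
      GG : ∑[ j < n₁ ] ∑[ k < n₁ ] t j k ≡ ∑[ j < n₁ ] degree G j
      GG = ∑-cong n₁ λ j j<n₁ → ∑-cong n₁ λ k k<n₁ →
        cong₂ (λ a b → 𝟙 (a ∧ b)) (⊕-adj-rl x j<n₁) (cong₂ _∧_ (⊕-adj-rl x k<n₁) (⊕-adj-ll j<n₁ k<n₁))
      GH : ∑[ j < n₁ ] ∑[ k < n₂ ] t j (n₁ + k) ≡ n₁ * degree H x
      GH = trans (∑-cong n₁ λ j j<n₁ → ∑-cong n₂ λ k _ → trans
             (cong₂ (λ a b → 𝟙 (a ∧ b)) (⊕-adj-rl x j<n₁) (cong₂ _∧_ (⊕-adj-rr x k) (⊕-adj-lr k j<n₁)))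
             (cong 𝟙 (∧-identityʳ _)))
           (∑-const n₁ _)
      HG : ∑[ j < n₂ ] ∑[ k < n₁ ] t (n₁ + j) k ≡ n₁ * degree H x
      HG = trans (∑-cong n₂ λ j _ → trans (∑-cong n₁ λ k k<n₁ → trans
             (cong₂ (λ a b → 𝟙 (a ∧ b)) (⊕-adj-rr x j) (cong₂ _∧_ (⊕-adj-rl x k<n₁) (⊕-adj-rl j k<n₁)))
             (cong 𝟙 (∧-identityʳ _))) (∑-const n₁ _))
           (sym (*-distribˡ-∑ n₂ n₁ _))
      HH : ∑[ j < n₂ ] ∑[ k < n₂ ] t (n₁ + j) (n₁ + k) ≡ ordTriDeg H x
      HH = ∑-cong n₂ λ j _ → ∑-cong n₂ λ k _ →
        cong₂ (λ a b → 𝟙 (a ∧ b)) (⊕-adj-rr x j) (cong₂ _∧_ (⊕-adj-rr x k) (⊕-adj-rr j k))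

  record Profile (G : Graphℕ) (d p : ℕ) : Set where
    field
      regular     : ∀ {x} → x < order G → degree G x ≡ d
      ordTriDeg-≤ : ∀ {x} → x < order G → ordTriDeg G x ≤ p
  open Profile public

  ∑-degree : ∀ {G d p} → Profile G d p → ∑[ x < order G ] degree G x ≡ order G * d
  ∑-degree {G} {d} P = trans (∑-cong (order G) (λ x → regular P)) (∑-const (order G) d)

  split-< : ∀ m {n x} → x < m + n → x < m ⊎ ∃[ y ] (x ≡ m + y × y < n)
  split-< zero    {x = x}     x<n       = inj₂ (x , refl , x<n)
  split-< (suc m) {x = zero}  _         = inj₁ (s≤s z≤n)
  split-< (suc m) {x = suc x} (s≤s x<m+n) with split-< m x<m+n
  ... | inj₁ x<m              = inj₁ (s≤s x<m)
  ... | inj₂ (y , refl , y<n) = inj₂ (y , refl , y<n)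

  ⊕-profile : ∀ {G H d₁ d₂ p₁ p₂ p} → Profile G d₁ p₁ → Profile H d₂ p₂ →
    d₁ + order H ≡ order G + d₂ →
    p₁ + 2 * (order H * d₁) + order H * d₂ ≤ p →
    order G * d₁ + 2 * (order G * d₂) + p₂ ≤ p →
    Profile (G ⊕ H) (d₁ + order H) p
  ⊕-profile {G} {H} {d₁} {d₂} {p₁} {p₂} {p} PG PH co-degree left≤p right≤p = record { regular = reg ; ordTriDeg-≤ = tri }
    where
    n₁ = order G
    n₂ = order H
    reg : ∀ {x} → x < n₁ + n₂ → degree (G ⊕ H) x ≡ d₁ + n₂
    reg {x} x<n with split-< n₁ x<n
    ... | inj₁ x<n₁              = trans (degree-⊕ˡ G H x<n₁) (cong (_+ n₂) (regular PG x<n₁))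
    ... | inj₂ (y , refl , y<n₂) = trans (degree-⊕ʳ G H y) (trans (cong (n₁ +_) (regular PH y<n₂)) (sym co-degree))
    tri : ∀ {x} → x < n₁ + n₂ → ordTriDeg (G ⊕ H) x ≤ p
    tri {x} x<n with split-< n₁ x<n
    ... | inj₁ x<n₁ = begin
      ordTriDeg (G ⊕ H) x                                          ≡⟨ ordTriDeg-⊕ˡ G H x<n₁ ⟩
      ordTriDeg G x + 2 * (n₂ * degree G x) + ∑[ j < n₂ ] degree H j
        ≤⟨ +-mono-≤ (+-mono-≤ (ordTriDeg-≤ PG x<n₁) (≤-reflexive (cong (λ d → 2 * (n₂ * d)) (regular PG x<n₁))))
                    (≤-reflexive (∑-degree PH)) ⟩
      p₁ + 2 * (n₂ * d₁) + n₂ * d₂                                 ≤⟨ left≤p ⟩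
      p                                                            ∎
      where open ≤-Reasoning
    ... | inj₂ (y , refl , y<n₂) = begin
      ordTriDeg (G ⊕ H) (n₁ + y)                                   ≡⟨ ordTriDeg-⊕ʳ G H y ⟩
      ∑[ j < n₁ ] degree G j + 2 * (n₁ * degree H y) + ordTriDeg H y
        ≤⟨ +-mono-≤ (+-mono-≤ (≤-reflexive (∑-degree PG)) (≤-reflexive (cong (λ d → 2 * (n₁ * d)) (regular PH y<n₂))))
                    (ordTriDeg-≤ PH y<n₂) ⟩
      n₁ * d₁ + 2 * (n₁ * d₂) + p₂                                 ≤⟨ right≤p ⟩
      p                                                            ∎
      where open ≤-Reasoning

  joins : ℕ → Graphℕ → Graphℕ → Graphℕ
  joins zero    B G₀ = G₀
  joins (suc j) B G₀ = B ⊕ joins j B G₀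

  module Joins {B G₀ : Graphℕ} {dB D₀ P₀ : ℕ} (B-profile : Profile B dB 0) (G₀-profile : Profile G₀ D₀ P₀)
               (co-degree : dB + order G₀ ≡ order B + D₀)
               (B-vertex₀ : 2 * (order G₀ * dB) + order G₀ * D₀ ≤ order B * dB + 2 * (order B * D₀) + P₀) where

    private
      nB = order B
      n : ℕ → ℕ
      n j = order (joins j B G₀)

    D : ℕ → ℕ
    D zero    = D₀
    D (suc j) = nB + D j

    P : ℕ → ℕ
    P zero    = P₀
    P (suc j) = nB * dB + 2 * (nB * D j) + P j

    co-degreeⱼ : ∀ j → dB + n j ≡ nB + D j
    co-degreeⱼ zero    = co-degree
    co-degreeⱼ (suc j) = trans (x∙yz≈y∙xz dB nB (n j)) (cong (nB +_) (co-degreeⱼ j))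

    -- The second component, that B-vertices of the next join stay within P, is carried along
    -- because co-degreeⱼ holds at every stage.
    joins-profile : ∀ j → Profile (joins j B G₀) (D j) (P j) × (2 * (n j * dB) + n j * D j ≤ P (suc j))
    joins-profile zero    = G₀-profile , B-vertex₀
    joins-profile (suc j) =
      subst (λ d → Profile (joins (suc j) B G₀) d (P (suc j))) (co-degreeⱼ j)
            (⊕-profile B-profile Pⱼ (co-degreeⱼ j) B-vertex ≤-refl) ,
      B-vertex′
      where
      Pⱼ = proj₁ (joins-profile j)
      B-vertex = proj₂ (joins-profile j)
      B-vertex′ : 2 * ((nB + n j) * dB) + (nB + n j) * (nB + D j) ≤ P (suc (suc j))
      B-vertex′ = begin
        2 * ((nB + n j) * dB) + (nB + n j) * (nB + D j)
          ≡⟨ expand nB (n j) dB (D j) ⟩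
        2 * (n j * dB) + n j * D j + (nB * (dB + n j) + nB * dB + nB * D j + nB * nB)
          ≡⟨ cong (λ c → 2 * (n j * dB) + n j * D j + (nB * c + nB * dB + nB * D j + nB * nB)) (co-degreeⱼ j) ⟩
        2 * (n j * dB) + n j * D j + (nB * (nB + D j) + nB * dB + nB * D j + nB * nB)
          ≤⟨ +-mono-≤ B-vertex (≤-reflexive (collect nB dB (D j))) ⟩
        P (suc j) + (nB * dB + 2 * (nB * (nB + D j)))
          ≡⟨ +-comm (P (suc j)) _ ⟩
        P (suc (suc j)) ∎
        where
        open ≤-Reasoning
        expand : ∀ b m d D → 2 * ((b + m) * d) + (b + m) * (b + D) ≡ 2 * (m * d) + m * D + (b * (d + m) + b * d + b * D + b * b)
        expand = solve-∀
        collect : ∀ b d D → b * (b + D) + b * d + b * D + b * b ≡ b * d + 2 * (b * (b + D))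
        collect = solve-∀

    order-joins : ∀ j → n j ≡ order G₀ + j * nB
    order-joins zero    = sym (+-identityʳ (order G₀))
    order-joins (suc j) = trans (cong (nB +_) (order-joins j)) (x∙yz≈y∙xz nB (order G₀) (j * nB))

    D-closed : ∀ j → D j ≡ D₀ + j * nB
    D-closed zero    = sym (+-identityʳ D₀)
    D-closed (suc j) = trans (cong (nB +_) (D-closed j)) (x∙yz≈y∙xz nB D₀ (j * nB))

    -- The deficit j·nB² sits on the left so that no truncated subtraction is needed.
    P-closed : ∀ j → P j + j * (nB * nB) ≡ P₀ + j * (nB * dB) + 2 * (j * (nB * D₀)) + (j * nB) * (j * nB)
    P-closed zero    = sym (trans (+-identityʳ (P₀ + 0 + 0)) (+-identityʳ (P₀ + 0)))
    P-closed (suc j) = begin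
      nB * dB + 2 * (nB * D j) + P j + suc j * (nB * nB)
        ≡⟨ cong (λ d → nB * dB + 2 * (nB * d) + P j + suc j * (nB * nB)) (D-closed j) ⟩
      nB * dB + 2 * (nB * (D₀ + j * nB)) + P j + suc j * (nB * nB)
        ≡⟨ split-off nB dB D₀ j (P j) ⟩
      nB * dB + 2 * (nB * (D₀ + j * nB)) + nB * nB + (P j + j * (nB * nB))
        ≡⟨ cong (nB * dB + 2 * (nB * (D₀ + j * nB)) + nB * nB +_) (P-closed j) ⟩
      nB * dB + 2 * (nB * (D₀ + j * nB)) + nB * nB + (P₀ + j * (nB * dB) + 2 * (j * (nB * D₀)) + (j * nB) * (j * nB))
        ≡⟨ collect nB dB D₀ j P₀ ⟩
      P₀ + suc j * (nB * dB) + 2 * (suc j * (nB * D₀)) + (suc j * nB) * (suc j * nB) ∎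
      where
      open ≡-Reasoning
      split-off : ∀ nB dB D₀ j p → nB * dB + 2 * (nB * (D₀ + j * nB)) + p + suc j * (nB * nB)
                                 ≡ nB * dB + 2 * (nB * (D₀ + j * nB)) + nB * nB + (p + j * (nB * nB))
      split-off = solve-∀
      collect : ∀ nB dB D₀ j P₀ →
        nB * dB + 2 * (nB * (D₀ + j * nB)) + nB * nB + (P₀ + j * (nB * dB) + 2 * (j * (nB * D₀)) + (j * nB) * (j * nB))
        ≡ P₀ + suc j * (nB * dB) + 2 * (suc j * (nB * D₀)) + (suc j * nB) * (suc j * nB)
      collect = solve-∀

  private
    self-join-base : ∀ n d → 2 * (n * d) + n * d ≡ n * d + 2 * (n * d) + 0
    self-join-base = solve-∀

  module SelfJoins {B : Graphℕ} {dB : ℕ} (B-profile : Profile B dB 0) =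
    Joins B-profile B-profile (+-comm dB (order B)) (≤-reflexive (self-join-base (order B) dB))

  -- Blow-ups of patterns of classes

  data Link : Set where
    none circ full : Link

  -- The meet for none < circ < full.
  infixl 7 _⊓ᴸ_
  _⊓ᴸ_ : Link → Link → Link
  none ⊓ᴸ _    = none
  circ ⊓ᴸ none = none
  circ ⊓ᴸ _    = circ
  full ⊓ᴸ R    = R

  ⊓ᴸ-sel : ∀ R R′ → R ⊓ᴸ R′ ≡ R ⊎ R ⊓ᴸ R′ ≡ R′
  ⊓ᴸ-sel none R′   = inj₁ refl
  ⊓ᴸ-sel circ none = inj₂ refl
  ⊓ᴸ-sel circ circ = inj₁ refl
  ⊓ᴸ-sel circ full = inj₁ refl
  ⊓ᴸ-sel full R′   = inj₂ refl

  #full : Link → ℕ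
  #full full = 1
  #full _    = 0

  #circ : Link → ℕ
  #circ circ = 1
  #circ _    = 0

  record Pattern : Set where
    field
      at        : ℕ → ℕ → Link
      at-sym    : ∀ c c′ → at c c′ ≡ at c′ c
      at-irrefl : ∀ c → at c c ≡ none
  open Pattern public

  ≡ᵇ-sym : ∀ m n → (m ≡ᵇ n) ≡ (n ≡ᵇ m)
  ≡ᵇ-sym zero    zero    = refl
  ≡ᵇ-sym zero    (suc n) = refl
  ≡ᵇ-sym (suc m) zero    = refl
  ≡ᵇ-sym (suc m) (suc n) = ≡ᵇ-sym m n

  ≡ᵇ-refl : ∀ n → (n ≡ᵇ n) ≡ true
  ≡ᵇ-refl zero    = refl
  ≡ᵇ-refl (suc n) = ≡ᵇ-refl n

  keyed : (part pair : ℕ → ℕ) → Pattern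
  keyed part pair = record
    { at        = linkBetween
    ; at-sym    = λ c c′ → cong₂ (λ p q → if p then none else if q then circ else full)
                                  (≡ᵇ-sym (part c) (part c′)) (≡ᵇ-sym (pair c) (pair c′))
    ; at-irrefl = λ c → cong (λ p → if p then none else if pair c ≡ᵇ pair c then circ else full)
                             (≡ᵇ-refl (part c))
    }
    where
    linkBetween : ℕ → ℕ → Link
    linkBetween c c′ = if part c ≡ᵇ part c′ then none else if pair c ≡ᵇ pair c′ then circ else full

  linkCount : (Link → ℕ) → ℕ → Pattern → ℕ → ℕ
  linkCount χ K P c = ∑[ c′ < K ] χ (at P c c′)

  weakest : Pattern → ℕ → ℕ → ℕ → Link
  weakest P c c₁ c₂ = at P c c₁ ⊓ᴸ at P c c₂ ⊓ᴸ at P c₁ c₂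

  triangleCount : (Link → ℕ) → ℕ → Pattern → ℕ → ℕ
  triangleCount χ K P c = ∑[ c₁ < K ] ∑[ c₂ < K ] χ (weakest P c c₁ c₂)

  -- The implicit proof is found by normalisation when each f c (c < K) computes to a numeral.
  by-evaluation : ∀ K (f : ℕ → ℕ) k {_ : True (all? λ (c : Fin K) → f (toℕ c) ≟ k)} → ∀ c → c < K → f c ≡ k
  by-evaluation K f k {checked} c c<K = subst (λ c → f c ≡ k) (toℕ-fromℕ< c<K) (toWitness checked (fromℕ< c<K))

  module BlowUp (h : ℕ) {{_ : NonZero h}} (e : ℕ) (e≤h : e ≤ h) where

    link : Link → ℕ → ℕ → Bool
    link none _ _ = false
    link circ u v = (u + v) % h <ᵇ e
    link full _ _ = true

    link-sym : ∀ R u v → link R u v ≡ link R v u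
    link-sym none u v = refl
    link-sym circ u v = cong (λ s → s % h <ᵇ e) (+-comm u v)
    link-sym full u v = refl

    linkDeg : Link → ℕ
    linkDeg none = 0
    linkDeg circ = e
    linkDeg full = h

    link-degree : ∀ R u → ∑[ v < h ] 𝟙 (link R u v) ≡ linkDeg R
    link-degree none u = ∑-zero h (λ _ _ → refl)
    link-degree circ u = begin
      ∑[ v < h ] 𝟙 ((u + v) % h <ᵇ e) ≡⟨ ∑-periodic h (λ s → 𝟙 (s % h <ᵇ e))
                                           (λ s → cong (λ t → 𝟙 (t <ᵇ e)) ([m+n]%n≡m%n s h)) u ⟩
      ∑[ v < h ] 𝟙 (v % h <ᵇ e)       ≡⟨ ∑-cong h (λ v v<h → cong (λ t → 𝟙 (t <ᵇ e)) (m<n⇒m%n≡m v<h)) ⟩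
      ∑[ v < h ] 𝟙 (v <ᵇ e)           ≡⟨ ∑-<ᵇ h e e≤h ⟩
      e                               ∎
      where open ≡-Reasoning
    link-degree full u = trans (∑-const h 1) (*-identityʳ h)

    linkDeg-linear : ∀ R → linkDeg R ≡ #full R * h + #circ R * e
    linkDeg-linear none = refl
    linkDeg-linear circ = sym (+-identityʳ e)
    linkDeg-linear full = sym (trans (+-identityʳ (h + 0)) (+-identityʳ h))

    ∑-linkDeg : ∀ n (f : ℕ → Link) → ∑[ i < n ] linkDeg (f i) ≡ ∑[ i < n ] #full (f i) * h + ∑[ i < n ] #circ (f i) * e
    ∑-linkDeg n f = begin
      ∑[ i < n ] linkDeg (f i)                             ≡⟨ ∑-cong n (λ i _ → linkDeg-linear (f i)) ⟩
      ∑[ i < n ] (#full (f i) * h + #circ (f i) * e)       ≡⟨ ∑-distrib-+ n _ _ ⟩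
      ∑[ i < n ] (#full (f i) * h) + ∑[ i < n ] (#circ (f i) * e)
        ≡⟨ cong₂ _+_ (sym (*-distribʳ-∑ n h (#full ∘ f))) (sym (*-distribʳ-∑ n e (#circ ∘ f))) ⟩
      ∑[ i < n ] #full (f i) * h + ∑[ i < n ] #circ (f i) * e ∎
      where
      open ≡-Reasoning

    ∑∑-linkDeg : ∀ m n (f : ℕ → ℕ → Link) →
      ∑[ i < m ] ∑[ j < n ] linkDeg (f i j) ≡ ∑[ i < m ] ∑[ j < n ] #full (f i j) * h + ∑[ i < m ] ∑[ j < n ] #circ (f i j) * e
    ∑∑-linkDeg m n f = begin
      ∑[ i < m ] ∑[ j < n ] linkDeg (f i j)
        ≡⟨ ∑-cong m (λ i _ → ∑-linkDeg n (f i)) ⟩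
      ∑[ i < m ] (∑[ j < n ] #full (f i j) * h + ∑[ j < n ] #circ (f i j) * e)
        ≡⟨ ∑-distrib-+ m _ _ ⟩
      ∑[ i < m ] (∑[ j < n ] #full (f i j) * h) + ∑[ i < m ] (∑[ j < n ] #circ (f i j) * e)
        ≡⟨ cong₂ _+_ (sym (*-distribʳ-∑ m h _)) (sym (*-distribʳ-∑ m e _)) ⟩
      ∑[ i < m ] ∑[ j < n ] #full (f i j) * h + ∑[ i < m ] ∑[ j < n ] #circ (f i j) * e ∎
      where open ≡-Reasoning

    link-triangles : ∀ R₁ R₂ R₃ u →
      ∑[ v < h ] ∑[ w < h ] 𝟙 (link R₁ u v ∧ link R₂ u w ∧ link R₃ v w) ≤ h * linkDeg (R₁ ⊓ᴸ R₂ ⊓ᴸ R₃)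
    link-triangles R₁ R₂ R₃ u = meet-bound (meet-bound via-R₁ via-R₂) via-R₃
      where
      open ≤-Reasoning
      T = ∑[ v < h ] ∑[ w < h ] 𝟙 (link R₁ u v ∧ link R₂ u w ∧ link R₃ v w)
      meet-bound : ∀ {R R′} → T ≤ h * linkDeg R → T ≤ h * linkDeg R′ → T ≤ h * linkDeg (R ⊓ᴸ R′)
      meet-bound {R} {R′} T≤R T≤R′ with ⊓ᴸ-sel R R′
      ... | inj₁ eq = subst (λ S → T ≤ h * linkDeg S) (sym eq) T≤R
      ... | inj₂ eq = subst (λ S → T ≤ h * linkDeg S) (sym eq) T≤R′
      via-R₁ : T ≤ h * linkDeg R₁
      via-R₁ = begin
        T                                       ≤⟨ ∑-mono-≤ h (λ v _ → ∑-mono-≤ h (λ w _ → 𝟙-∧ˡ (link R₁ u v) _)) ⟩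
        ∑[ v < h ] ∑[ w < h ] 𝟙 (link R₁ u v)   ≡⟨ ∑-cong h (λ v _ → ∑-const h _) ⟩
        ∑[ v < h ] (h * 𝟙 (link R₁ u v))        ≡⟨ *-distribˡ-∑ h h _ ⟨
        h * ∑[ v < h ] 𝟙 (link R₁ u v)          ≡⟨ cong (h *_) (link-degree R₁ u) ⟩
        h * linkDeg R₁                          ∎
      via-R₂ : T ≤ h * linkDeg R₂
      via-R₂ = begin
        T                                       ≤⟨ ∑-mono-≤ h (λ v _ → ∑-mono-≤ h (λ w _ →
                                                     ≤-trans (𝟙-∧ʳ (link R₁ u v) _) (𝟙-∧ˡ (link R₂ u w) _))) ⟩
        ∑[ v < h ] ∑[ w < h ] 𝟙 (link R₂ u w)   ≡⟨ ∑-cong h (λ v _ → link-degree R₂ u) ⟩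
        ∑[ v < h ] linkDeg R₂                   ≡⟨ ∑-const h _ ⟩
        h * linkDeg R₂                          ∎
      via-R₃ : T ≤ h * linkDeg R₃
      via-R₃ = begin
        T                                       ≤⟨ ∑-mono-≤ h (λ v _ → ∑-mono-≤ h (λ w _ →
                                                     ≤-trans (𝟙-∧ʳ (link R₁ u v) _) (𝟙-∧ʳ (link R₂ u w) _))) ⟩
        ∑[ v < h ] ∑[ w < h ] 𝟙 (link R₃ v w)   ≡⟨ ∑-cong h (λ v _ → link-degree R₃ v) ⟩
        ∑[ v < h ] linkDeg R₃                   ≡⟨ ∑-const h _ ⟩
        h * linkDeg R₃                          ∎

    blowUp : ℕ → Pattern → Graphℕ
    blowUp K P = record
      { order      = K * h
      ; adj        = λ i j → link (at P (i / h) (j / h)) (i % h) (j % h)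
      ; adj-sym    = λ i j → trans (cong (λ R → link R (i % h) (j % h)) (at-sym P (i / h) (j / h)))
                                   (link-sym (at P (j / h) (i / h)) (i % h) (j % h))
      ; adj-irrefl = λ i → cong (λ R → link R (i % h) (i % h)) (at-irrefl P (i / h))
      }

    %-block : ∀ c {u} → u < h → (c * h + u) % h ≡ u
    %-block c {u} u<h = trans (cong (_% h) (+-comm (c * h) u)) (trans ([m+kn]%n≡m%n u c h) (m<n⇒m%n≡m u<h))

    /-block : ∀ c {u} → u < h → (c * h + u) / h ≡ c
    /-block c {u} u<h = begin
      (c * h + u) / h     ≡⟨ +-distrib-/ (c * h) u (subst₂ (λ a b → a + b < h) (sym (m*n%n≡0 c h)) (sym (m<n⇒m%n≡m u<h)) u<h) ⟩
      c * h / h + u / h   ≡⟨ cong₂ _+_ (m*n/n≡m c h) (m<n⇒m/n≡0 u<h) ⟩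
      c + 0               ≡⟨ +-identityʳ c ⟩
      c                   ∎
      where open ≡-Reasoning

    block-decomp : ∀ x → x / h * h + x % h ≡ x
    block-decomp x = trans (+-comm (x / h * h) (x % h)) (sym (m≡m%n+[m/n]*n x h))

    module _ (K : ℕ) (P : Pattern) where
      private
        A = adj (blowUp K P)

      blowUp-adj : ∀ c c′ {u u′} → u < h → u′ < h → A (c * h + u) (c′ * h + u′) ≡ link (at P c c′) u u′
      blowUp-adj c c′ u<h u′<h =
        cong₂ (λ R (uv : ℕ × ℕ) → link R (proj₁ uv) (proj₂ uv))
              (cong₂ (at P) (/-block c u<h) (/-block c′ u′<h)) (cong₂ _,_ (%-block c u<h) (%-block c′ u′<h))

      blowUp-degree : ∀ c {u} → u < h → degree (blowUp K P) (c * h + u) ≡ ∑[ c′ < K ] linkDeg (at P c c′)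
      blowUp-degree c {u} u<h = begin
        degree (blowUp K P) (c * h + u)
          ≡⟨ ∑-blocks K h _ ⟩
        ∑[ c′ < K ] ∑[ u′ < h ] 𝟙 (A (c * h + u) (c′ * h + u′))
          ≡⟨ ∑-cong K (λ c′ _ → ∑-cong h (λ u′ u′<h → cong 𝟙 (blowUp-adj c c′ u<h u′<h))) ⟩
        ∑[ c′ < K ] ∑[ u′ < h ] 𝟙 (link (at P c c′) u u′)
          ≡⟨ ∑-cong K (λ c′ _ → link-degree (at P c c′) u) ⟩
        ∑[ c′ < K ] linkDeg (at P c c′) ∎
        where open ≡-Reasoning

      blowUp-ordTriDeg : ∀ c {u} → u < h →
        ordTriDeg (blowUp K P) (c * h + u) ≤ h * ∑[ c₁ < K ] ∑[ c₂ < K ] linkDeg (weakest P c c₁ c₂)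
      blowUp-ordTriDeg c {u} u<h = begin
        ordTriDeg (blowUp K P) x
          ≡⟨ ∑-blocks K h _ ⟩
        ∑[ c₁ < K ] ∑[ u₁ < h ] ∑[ y < K * h ] t (c₁ * h + u₁) y
          ≡⟨ ∑-cong K (λ c₁ _ → ∑-cong h (λ u₁ _ → ∑-blocks K h _)) ⟩
        ∑[ c₁ < K ] ∑[ u₁ < h ] ∑[ c₂ < K ] ∑[ u₂ < h ] t (c₁ * h + u₁) (c₂ * h + u₂)
          ≡⟨ ∑-cong K (λ c₁ _ → ∑-comm h K _) ⟩
        ∑[ c₁ < K ] ∑[ c₂ < K ] ∑[ u₁ < h ] ∑[ u₂ < h ] t (c₁ * h + u₁) (c₂ * h + u₂)
          ≤⟨ ∑-mono-≤ K (λ c₁ _ → ∑-mono-≤ K (λ c₂ _ → block c₁ c₂)) ⟩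
        ∑[ c₁ < K ] ∑[ c₂ < K ] (h * linkDeg (weakest P c c₁ c₂))
          ≡⟨ ∑-cong K (λ c₁ _ → *-distribˡ-∑ K h _) ⟨
        ∑[ c₁ < K ] (h * ∑[ c₂ < K ] linkDeg (weakest P c c₁ c₂))
          ≡⟨ *-distribˡ-∑ K h _ ⟨
        h * ∑[ c₁ < K ] ∑[ c₂ < K ] linkDeg (weakest P c c₁ c₂) ∎
        where
        open ≤-Reasoning
        x = c * h + u
        t : ℕ → ℕ → ℕ
        t y z = 𝟙 (A x y ∧ A x z ∧ A y z)
        block : ∀ c₁ c₂ →
          ∑[ u₁ < h ] ∑[ u₂ < h ] t (c₁ * h + u₁) (c₂ * h + u₂) ≤ h * linkDeg (weakest P c c₁ c₂)
        block c₁ c₂ = ≤-trans (≤-reflexive (∑-cong h λ u₁ u₁<h → ∑-cong h λ u₂ u₂<h →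
                        cong₂ (λ a b → 𝟙 (a ∧ b)) (blowUp-adj c c₁ u<h u₁<h)
                              (cong₂ _∧_ (blowUp-adj c c₂ u<h u₂<h) (blowUp-adj c₁ c₂ u₁<h u₂<h))))
                      (link-triangles (at P c c₁) (at P c c₂) (at P c₁ c₂) u)

      blowUp-profile : ∀ {α β γ δ} →
        (∀ c → c < K → linkCount #full K P c ≡ α) → (∀ c → c < K → linkCount #circ K P c ≡ β) →
        (∀ c → c < K → triangleCount #full K P c ≡ γ) → (∀ c → c < K → triangleCount #circ K P c ≡ δ) →
        Profile (blowUp K P) (α * h + β * e) (h * (γ * h + δ * e))
      blowUp-profile {α} {β} {γ} {δ} full-nbrs circ-nbrs full-tri circ-tri = record
        { regular     = λ {x} x<Kh → subst (λ y → degree (blowUp K P) y ≡ _) (block-decomp x)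
                                       (trans (blowUp-degree (x / h) (m%n<n x h)) (class-degree (x / h) (m<n*o⇒m/o<n x<Kh)))
        ; ordTriDeg-≤ = λ {x} x<Kh → subst (λ y → ordTriDeg (blowUp K P) y ≤ _) (block-decomp x)
                                       (≤-trans (blowUp-ordTriDeg (x / h) (m%n<n x h)) (class-triangles (x / h) (m<n*o⇒m/o<n x<Kh)))
        }
        where
        class-degree : ∀ c → c < K → ∑[ c′ < K ] linkDeg (at P c c′) ≡ α * h + β * e
        class-degree c c<K = trans (∑-linkDeg K (at P c)) (cong₂ (λ a b → a * h + b * e) (full-nbrs c c<K) (circ-nbrs c c<K))
        class-triangles : ∀ c → c < K → h * ∑[ c₁ < K ] ∑[ c₂ < K ] linkDeg (weakest P c c₁ c₂) ≤ h * (γ * h + δ * e)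
        class-triangles c c<K = ≤-reflexive (cong (h *_) (trans (∑∑-linkDeg K K (weakest P c))
          (cong₂ (λ a b → a * h + b * e) (full-tri c c<K) (circ-tri c c<K))))

  bipartite : Pattern
  bipartite = keyed (λ c → c) (λ _ → 0)

  -- Parts {0,3}, {1,4}, {2,5}; the sparse pairs {0,1}, {2,3}, {4,5} close a hexagon with them.
  hexagon : Pattern
  hexagon = keyed (_% 3) (_/ 2)

  module Gadgets (h : ℕ) {{_ : NonZero h}} (e : ℕ) (e≤h : e ≤ h) where
    open BlowUp h e e≤h

    bipartite-profile : Profile (blowUp 2 bipartite) e 0
    bipartite-profile = subst₂ (Profile (blowUp 2 bipartite)) (+-identityʳ e) (*-zeroʳ h)
      (blowUp-profile 2 bipartite
        (by-evaluation 2 (linkCount #full 2 bipartite) 0) (by-evaluation 2 (linkCount #circ 2 bipartite) 1)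
        (by-evaluation 2 (triangleCount #full 2 bipartite) 0) (by-evaluation 2 (triangleCount #circ 2 bipartite) 0))

    hexagon-profile : Profile (blowUp 6 hexagon) (3 * h + 1 * e) (h * (2 * h + 6 * e))
    hexagon-profile = blowUp-profile 6 hexagon
      (by-evaluation 6 (linkCount #full 6 hexagon) 3) (by-evaluation 6 (linkCount #circ 6 hexagon) 1)
      (by-evaluation 6 (triangleCount #full 6 hexagon) 2) (by-evaluation 6 (triangleCount #circ 6 hexagon) 6)

module Densities where

  open import Data.Nat as ℕ using (ℕ; zero; suc; NonZero; _∸_; z≤n)
  import Data.Nat.Properties as ℕ
  open import Data.Nat.Combinatorics using (_C_; nCk+nC[k+1]≡[n+1]C[k+1]; nC1≡n)
  import Data.Nat.Tactic.RingSolver as ℕ-Solver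
  open import Data.Integer as ℤ using (ℤ; +_; -[1+_]; +[1+_]; +≤+; ∣_∣)
  import Data.Integer.Properties as ℤ
  import Data.Integer.Tactic.RingSolver as ℤ-Solver
  open import Data.Rational as ℚ
    using (ℚ; mkℚ; _/_; _+_; _*_; _-_; -_; _≤_; _<_; 0ℚ; toℚᵘ; ↥_; ↧ₙ_; Positive; NonNegative)
  open import Data.Rational.Properties as ℚ using (toℚᵘ-injective; toℚᵘ-fromℚᵘ; toℚᵘ-homo-+; toℚᵘ-homo-*;
                                                toℚᵘ-mono-≤; toℚᵘ-cancel-≤; ↥p/↧p≡p; normalize-pos; normalize-nonNeg)
  import Data.Rational.Unnormalised as ℚᵘ
  import Data.Rational.Unnormalised.Properties as ℚᵘ
  open import Data.Rational.Solver using (module +-*-Solver)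
  open +-*-Solver using (solve; _:=_; _:+_; _:*_; _:-_)
  open import Algebra.Bundles using (CommutativeRing)
  open import Algebra.Properties.CommutativeSemigroup (CommutativeRing.*-commutativeSemigroup ℚ.+-*-commutativeRing)
    using (x∙yz≈y∙xz)
  open import Data.Fin.Properties using (toℕ<n)
  open import Data.Empty using (⊥-elim)
  open import Data.Product using (∃-syntax; _×_; _,_)
  open import Relation.Binary.PropositionalEquality
  open import Defs using (edges; tmax; ℕtoℚ; TauLe; lowerEnd; upperEnd; breakPt; bound₁; bound₂)
  open Counting

  ℤtoℚ : ℤ → ℚ
  ℤtoℚ i = i / 1

  private
    toℚᵘ-ℤtoℚ : ∀ i → toℚᵘ (ℤtoℚ i) ℚᵘ.≃ ℚᵘ.mkℚᵘ i 0
    toℚᵘ-ℤtoℚ i = toℚᵘ-fromℚᵘ (ℚᵘ.mkℚᵘ i 0)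

  ℤtoℚ-+ : ∀ i j → ℤtoℚ (i ℤ.+ j) ≡ ℤtoℚ i + ℤtoℚ j
  ℤtoℚ-+ i j = toℚᵘ-injective (begin
    toℚᵘ (ℤtoℚ (i ℤ.+ j))                  ≈⟨ toℚᵘ-ℤtoℚ (i ℤ.+ j) ⟩
    ℚᵘ.mkℚᵘ (i ℤ.+ j) 0                    ≈⟨ ℚᵘ.*≡* (+-identity i j) ⟩
    ℚᵘ.mkℚᵘ i 0 ℚᵘ.+ ℚᵘ.mkℚᵘ j 0           ≈⟨ ℚᵘ.+-cong (toℚᵘ-ℤtoℚ i) (toℚᵘ-ℤtoℚ j) ⟨
    toℚᵘ (ℤtoℚ i) ℚᵘ.+ toℚᵘ (ℤtoℚ j)       ≈⟨ toℚᵘ-homo-+ (ℤtoℚ i) (ℤtoℚ j) ⟨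
    toℚᵘ (ℤtoℚ i + ℤtoℚ j)                 ∎)
    where
    open ℚᵘ.≃-Reasoning
    +-identity : ∀ i j → (i ℤ.+ j) ℤ.* + 1 ≡ (i ℤ.* + 1 ℤ.+ j ℤ.* + 1) ℤ.* + 1
    +-identity = ℤ-Solver.solve-∀

  ℤtoℚ-* : ∀ i j → ℤtoℚ (i ℤ.* j) ≡ ℤtoℚ i * ℤtoℚ j
  ℤtoℚ-* i j = toℚᵘ-injective (begin
    toℚᵘ (ℤtoℚ (i ℤ.* j))                  ≈⟨ toℚᵘ-ℤtoℚ (i ℤ.* j) ⟩
    ℚᵘ.mkℚᵘ i 0 ℚᵘ.* ℚᵘ.mkℚᵘ j 0           ≈⟨ ℚᵘ.*-cong (toℚᵘ-ℤtoℚ i) (toℚᵘ-ℤtoℚ j) ⟨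
    toℚᵘ (ℤtoℚ i) ℚᵘ.* toℚᵘ (ℤtoℚ j)       ≈⟨ toℚᵘ-homo-* (ℤtoℚ i) (ℤtoℚ j) ⟨
    toℚᵘ (ℤtoℚ i * ℤtoℚ j)                 ∎)
    where open ℚᵘ.≃-Reasoning

  ℕtoℚ-+ : ∀ m n → ℕtoℚ (m ℕ.+ n) ≡ ℕtoℚ m + ℕtoℚ n
  ℕtoℚ-+ m n = trans (cong ℤtoℚ (ℤ.pos-+ m n)) (ℤtoℚ-+ (+ m) (+ n))

  ℕtoℚ-* : ∀ m n → ℕtoℚ (m ℕ.* n) ≡ ℕtoℚ m * ℕtoℚ n
  ℕtoℚ-* m n = trans (cong ℤtoℚ (ℤ.pos-* m n)) (ℤtoℚ-* (+ m) (+ n))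

  ℕtoℚ-mono-≤ : ∀ {m n} → m ℕ.≤ n → ℕtoℚ m ≤ ℕtoℚ n
  ℕtoℚ-mono-≤ {m} {n} m≤n = toℚᵘ-cancel-≤
    (ℚᵘ.≤-respˡ-≃ (ℚᵘ.≃-sym (toℚᵘ-ℤtoℚ (+ m))) (ℚᵘ.≤-respʳ-≃ (ℚᵘ.≃-sym (toℚᵘ-ℤtoℚ (+ n)))
      (ℚᵘ.*≤* (subst₂ ℤ._≤_ (sym (ℤ.*-identityʳ (+ m))) (sym (ℤ.*-identityʳ (+ n))) (+≤+ m≤n)))))

  ℕtoℚ-cancel-≤ : ∀ {m n} → ℕtoℚ m ≤ ℕtoℚ n → m ℕ.≤ n
  ℕtoℚ-cancel-≤ {m} {n} le
    with ℚᵘ.≤-respˡ-≃ (toℚᵘ-ℤtoℚ (+ m)) (ℚᵘ.≤-respʳ-≃ (toℚᵘ-ℤtoℚ (+ n)) (toℚᵘ-mono-≤ le))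
  ... | ℚᵘ.*≤* m*1≤n*1 with subst₂ ℤ._≤_ (ℤ.*-identityʳ (+ m)) (ℤ.*-identityʳ (+ n)) m*1≤n*1
  ...   | +≤+ m≤n = m≤n

  /-*-denominator : ∀ i n .{{_ : NonZero n}} → (i / n) * ℕtoℚ n ≡ ℤtoℚ i
  /-*-denominator i (suc k) = toℚᵘ-injective (begin
    toℚᵘ ((i / suc k) * ℕtoℚ (suc k))
      ≈⟨ toℚᵘ-homo-* (i / suc k) (ℕtoℚ (suc k)) ⟩
    toℚᵘ (i / suc k) ℚᵘ.* toℚᵘ (ℕtoℚ (suc k))
      ≈⟨ ℚᵘ.*-cong (toℚᵘ-fromℚᵘ (ℚᵘ.mkℚᵘ i k)) (toℚᵘ-ℤtoℚ (+ suc k)) ⟩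
    ℚᵘ.mkℚᵘ i k ℚᵘ.* ℚᵘ.mkℚᵘ (+ suc k) 0
      ≈⟨ ℚᵘ.*≡* (cancel i (suc k)) ⟩
    ℚᵘ.mkℚᵘ i 0
      ≈⟨ toℚᵘ-ℤtoℚ i ⟨
    toℚᵘ (ℤtoℚ i) ∎)
    where
    open ℚᵘ.≃-Reasoning
    cancel : ∀ i n → (i ℤ.* + n) ℤ.* + 1 ≡ i ℤ.* + (n ℕ.* 1)
    cancel i n = trans (ℤ.*-identityʳ _) (cong (λ m → i ℤ.* + m) (sym (ℕ.*-identityʳ n)))

  *-denominator : ∀ q → q * ℕtoℚ (↧ₙ q) ≡ ℤtoℚ (↥ q)
  *-denominator q = trans (cong (_* ℕtoℚ (↧ₙ q)) (sym (↥p/↧p≡p q))) (/-*-denominator (↥ q) (↧ₙ q))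

  ℕtoℚ-pos : ∀ n .{{_ : NonZero n}} → Positive (ℕtoℚ n)
  ℕtoℚ-pos n = normalize-pos n 1

  ℕtoℚ-nonNeg : ∀ n → NonNegative (ℕtoℚ n)
  ℕtoℚ-nonNeg n = normalize-nonNeg n 1

  private
    cleared : ∀ q {a} y → ↥ q ≡ + a → q * ℕtoℚ y * ℕtoℚ (↧ₙ q) ≡ ℕtoℚ (a ℕ.* y)
    cleared q {a} y ↥q≡a = begin
      q * Y * B     ≡⟨ ℚ.*-assoc q Y B ⟩
      q * (Y * B)   ≡⟨ cong (q *_) (ℚ.*-comm Y B) ⟩
      q * (B * Y)   ≡⟨ ℚ.*-assoc q B Y ⟨
      q * B * Y     ≡⟨ cong (_* Y) (trans (*-denominator q) (cong ℤtoℚ ↥q≡a)) ⟩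
      ℕtoℚ a * Y    ≡⟨ ℕtoℚ-* a y ⟨
      ℕtoℚ (a ℕ.* y) ∎
      where
      open ≡-Reasoning
      Y = ℕtoℚ y
      B = ℕtoℚ (↧ₙ q)

  *ℕ≤ℕ : ∀ q {a x y} → ↥ q ≡ + a → a ℕ.* y ℕ.≤ ↧ₙ q ℕ.* x → q * ℕtoℚ y ≤ ℕtoℚ x
  *ℕ≤ℕ q {a} {x} {y} ↥q≡a ay≤bx = ℚ.*-cancelʳ-≤-pos (ℕtoℚ (↧ₙ q)) {{ℕtoℚ-pos (↧ₙ q)}} (begin
    q * ℕtoℚ y * ℕtoℚ (↧ₙ q)    ≡⟨ cleared q y ↥q≡a ⟩
    ℕtoℚ (a ℕ.* y)              ≤⟨ ℕtoℚ-mono-≤ ay≤bx ⟩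
    ℕtoℚ (↧ₙ q ℕ.* x)           ≡⟨ cong ℕtoℚ (ℕ.*-comm (↧ₙ q) x) ⟩
    ℕtoℚ (x ℕ.* ↧ₙ q)           ≡⟨ ℕtoℚ-* x (↧ₙ q) ⟩
    ℕtoℚ x * ℕtoℚ (↧ₙ q)        ∎)
    where open ℚ.≤-Reasoning

  ℕ≤*ℕ : ∀ q {a x y} → ↥ q ≡ + a → ↧ₙ q ℕ.* x ℕ.≤ a ℕ.* y → ℕtoℚ x ≤ q * ℕtoℚ y
  ℕ≤*ℕ q {a} {x} {y} ↥q≡a bx≤ay = ℚ.*-cancelʳ-≤-pos (ℕtoℚ (↧ₙ q)) {{ℕtoℚ-pos (↧ₙ q)}} (begin
    ℕtoℚ x * ℕtoℚ (↧ₙ q)        ≡⟨ ℕtoℚ-* x (↧ₙ q) ⟨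
    ℕtoℚ (x ℕ.* ↧ₙ q)           ≡⟨ cong ℕtoℚ (ℕ.*-comm x (↧ₙ q)) ⟩
    ℕtoℚ (↧ₙ q ℕ.* x)           ≤⟨ ℕtoℚ-mono-≤ bx≤ay ⟩
    ℕtoℚ (a ℕ.* y)              ≡⟨ cleared q y ↥q≡a ⟨
    q * ℕtoℚ y * ℕtoℚ (↧ₙ q)    ∎)
    where open ℚ.≤-Reasoning

  private
    toℚᵘ-≤ : ∀ {q} i k → i / suc k ≤ q → i ℤ.* ℤ.+ ↧ₙ q ℤ.≤ ↥ q ℤ.* ℤ.+ suc k
    toℚᵘ-≤ {mkℚ _ _ _} i k le with ℚᵘ.≤-respˡ-≃ (toℚᵘ-fromℚᵘ (ℚᵘ.mkℚᵘ i k)) (toℚᵘ-mono-≤ le)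
    ... | ℚᵘ.*≤* cross = cross

    ≤-toℚᵘ : ∀ {q} i k → q ≤ i / suc k → ↥ q ℤ.* ℤ.+ suc k ℤ.≤ i ℤ.* ℤ.+ ↧ₙ q
    ≤-toℚᵘ {mkℚ _ _ _} i k le with ℚᵘ.≤-respʳ-≃ (toℚᵘ-fromℚᵘ (ℚᵘ.mkℚᵘ i k)) (toℚᵘ-mono-≤ le)
    ... | ℚᵘ.*≤* cross = cross

    +≤+⁻¹ : ∀ {m n} → + m ℤ.≤ + n → m ℕ.≤ n
    +≤+⁻¹ (+≤+ m≤n) = m≤n

  frac≤⇒ : ∀ {q a} i k → + i / suc k ≤ q → ↥ q ≡ + a → i ℕ.* ↧ₙ q ℕ.≤ a ℕ.* suc k
  frac≤⇒ {q} {a} i k le ↥q≡a = +≤+⁻¹ (subst₂ ℤ._≤_ (sym (ℤ.pos-* i (↧ₙ q)))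
    (trans (cong (ℤ._* + suc k) ↥q≡a) (sym (ℤ.pos-* a (suc k)))) (toℚᵘ-≤ (+ i) k le))

  ≤frac⇒ : ∀ {q a} i k → q ≤ + i / suc k → ↥ q ≡ + a → a ℕ.* suc k ℕ.≤ i ℕ.* ↧ₙ q
  ≤frac⇒ {q} {a} i k le ↥q≡a = +≤+⁻¹ (subst₂ ℤ._≤_
    (trans (cong (ℤ._* + suc k) ↥q≡a) (sym (ℤ.pos-* a (suc k)))) (sym (ℤ.pos-* i (↧ₙ q))) (≤-toℚᵘ (+ i) k le))

  nonNeg-numerator : ∀ {q} → 0ℚ ≤ q → ∃[ a ] ↥ q ≡ + a
  nonNeg-numerator {mkℚ (+ a) _ _}     _   = a , refl
  nonNeg-numerator {q@(mkℚ -[1+ _ ] _ _)} 0≤q = ⊥-elim (ℤ.NonNegative.nonNeg (ℚ.nonNegative 0≤q))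

  +-cancelʳ-≤ : ∀ x y z → x + z ≤ y + z → x ≤ y
  +-cancelʳ-≤ x y z le = begin
    x              ≡⟨ cancel x z ⟨
    x + z - z      ≤⟨ ℚ.+-monoˡ-≤ (- z) le ⟩
    y + z - z      ≡⟨ cancel y z ⟩
    y              ∎
    where
    open ℚ.≤-Reasoning
    cancel : ∀ x z → x + z - z ≡ x
    cancel = solve 2 (λ x z → x :+ z :- z := x) refl

  ≤-from-cleared : ∀ c {W Z X p N} .{{_ : NonZero W}} →
    c * ℕtoℚ W + ℕtoℚ Z ≡ ℕtoℚ X → p ℕ.* W ℕ.+ Z ℕ.* N ℕ.≤ X ℕ.* N → ℕtoℚ p ≤ c * ℕtoℚ N
  ≤-from-cleared c {W} {Z} {X} {p} {N} cleared cross = ℚ.*-cancelʳ-≤-pos (ℕtoℚ W) {{ℕtoℚ-pos W}}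
    (+-cancelʳ-≤ _ _ (ℕtoℚ (Z ℕ.* N)) (begin
      ℕtoℚ p * ℕtoℚ W + ℕtoℚ (Z ℕ.* N)             ≡⟨ cong (_+ ℕtoℚ (Z ℕ.* N)) (ℕtoℚ-* p W) ⟨
      ℕtoℚ (p ℕ.* W) + ℕtoℚ (Z ℕ.* N)              ≡⟨ ℕtoℚ-+ (p ℕ.* W) (Z ℕ.* N) ⟨
      ℕtoℚ (p ℕ.* W ℕ.+ Z ℕ.* N)                   ≤⟨ ℕtoℚ-mono-≤ cross ⟩
      ℕtoℚ (X ℕ.* N)                               ≡⟨ ℕtoℚ-* X N ⟩
      ℕtoℚ X * ℕtoℚ N                              ≡⟨ cong (_* ℕtoℚ N) cleared ⟨
      (c * ℕtoℚ W + ℕtoℚ Z) * ℕtoℚ N               ≡⟨ regroup c (ℕtoℚ W) (ℕtoℚ Z) (ℕtoℚ N) ⟩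
      c * ℕtoℚ N * ℕtoℚ W + ℕtoℚ Z * ℕtoℚ N        ≡⟨ cong (λ z → c * ℕtoℚ N * ℕtoℚ W + z) (ℕtoℚ-* Z N) ⟨
      c * ℕtoℚ N * ℕtoℚ W + ℕtoℚ (Z ℕ.* N)         ∎))
    where
    open ℚ.≤-Reasoning
    regroup : ∀ c W Z N → (c * W + Z) * N ≡ c * N * W + Z * N
    regroup = solve 4 (λ c W Z N → (c :* W :+ Z) :* N := c :* N :* W :+ Z :* N) refl

  -- From families of regular graphs to τ

  2*nC2+n≡n*n : ∀ n → 2 ℕ.* (n C 2) ℕ.+ n ≡ n ℕ.* n
  2*nC2+n≡n*n zero    = refl
  2*nC2+n≡n*n (suc n) = begin
    2 ℕ.* (suc n C 2) ℕ.+ suc n          ≡⟨ cong (λ c → 2 ℕ.* c ℕ.+ suc n) (nCk+nC[k+1]≡[n+1]C[k+1] n 1) ⟨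
    2 ℕ.* (n C 1 ℕ.+ n C 2) ℕ.+ suc n    ≡⟨ cong (λ c → 2 ℕ.* (c ℕ.+ n C 2) ℕ.+ suc n) (nC1≡n n) ⟩
    2 ℕ.* (n ℕ.+ n C 2) ℕ.+ suc n        ≡⟨ expand n (n C 2) ⟩
    (2 ℕ.* (n C 2) ℕ.+ n) ℕ.+ (2 ℕ.* n ℕ.+ 1)   ≡⟨ cong (ℕ._+ (2 ℕ.* n ℕ.+ 1)) (2*nC2+n≡n*n n) ⟩
    n ℕ.* n ℕ.+ (2 ℕ.* n ℕ.+ 1)          ≡⟨ square n ⟩
    suc n ℕ.* suc n                      ∎
    where
    open ≡-Reasoning
    expand : ∀ n c → 2 ℕ.* (n ℕ.+ c) ℕ.+ suc n ≡ (2 ℕ.* c ℕ.+ n) ℕ.+ (2 ℕ.* n ℕ.+ 1)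
    expand = ℕ-Solver.solve-∀
    square : ∀ n → n ℕ.* n ℕ.+ (2 ℕ.* n ℕ.+ 1) ≡ suc n ℕ.* suc n
    square = ℕ-Solver.solve-∀

  ≤-∣numerator∣ : ∀ c → c ≤ ℕtoℚ ∣ ↥ c ∣
  ≤-∣numerator∣ c@(mkℚ (+ k) d _) =
    subst (_≤ ℕtoℚ k) (ℚ.*-identityʳ c) (*ℕ≤ℕ c refl (ℕ.≤-trans (ℕ.≤-reflexive (ℕ.*-identityʳ k)) (ℕ.m≤n*m k (suc d))))
  ≤-∣numerator∣ c@(mkℚ -[1+ k ] d _) =
    ℚ.≤-trans (ℚ.<⇒≤ (ℚ.negative⁻¹ c)) (ℚ.nonNegative⁻¹ (ℕtoℚ (suc k)) {{ℕtoℚ-nonNeg (suc k)}})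

  private
    linear≤binomial : ∀ m x → 4 ℕ.* x ℕ.< m → x ℕ.* (3 ℕ.* m ℕ.+ 1) ℕ.≤ 2 ℕ.* (m C 2)
    linear≤binomial m x 4x<m = ℕ.+-cancelʳ-≤ m _ _ (begin
      x ℕ.* (3 ℕ.* m ℕ.+ 1) ℕ.+ m          ≡⟨ expand x m ⟩
      3 ℕ.* (x ℕ.* m) ℕ.+ x ℕ.+ m          ≤⟨ ℕ.+-monoˡ-≤ m (ℕ.+-monoʳ-≤ (3 ℕ.* (x ℕ.* m)) (ℕ.m≤m*n x m {{m≢0}})) ⟩
      3 ℕ.* (x ℕ.* m) ℕ.+ x ℕ.* m ℕ.+ m    ≡⟨ collect x m ⟩
      suc (4 ℕ.* x) ℕ.* m                  ≤⟨ ℕ.*-monoˡ-≤ m 4x<m ⟩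
      m ℕ.* m                              ≡⟨ 2*nC2+n≡n*n m ⟨
      2 ℕ.* (m C 2) ℕ.+ m                  ∎)
      where
      open ℕ.≤-Reasoning
      m≢0 : NonZero m
      m≢0 = ℕ.>-nonZero (ℕ.≤-<-trans z≤n 4x<m)
      expand : ∀ x m → x ℕ.* (3 ℕ.* m ℕ.+ 1) ℕ.+ m ≡ 3 ℕ.* (x ℕ.* m) ℕ.+ x ℕ.+ m
      expand = ℕ-Solver.solve-∀
      collect : ∀ x m → 3 ℕ.* (x ℕ.* m) ℕ.+ x ℕ.* m ℕ.+ m ≡ suc (4 ℕ.* x) ℕ.* m
      collect = ℕ-Solver.solve-∀

    square-split : ∀ m → suc m ℕ.* suc m ≡ 2 ℕ.* (m C 2) ℕ.+ (3 ℕ.* m ℕ.+ 1)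
    square-split m = begin
      suc m ℕ.* suc m                          ≡⟨ expand m ⟩
      m ℕ.* m ℕ.+ (2 ℕ.* m ℕ.+ 1)              ≡⟨ cong (ℕ._+ (2 ℕ.* m ℕ.+ 1)) (2*nC2+n≡n*n m) ⟨
      2 ℕ.* (m C 2) ℕ.+ m ℕ.+ (2 ℕ.* m ℕ.+ 1)  ≡⟨ regroup (2 ℕ.* (m C 2)) m ⟩
      2 ℕ.* (m C 2) ℕ.+ (3 ℕ.* m ℕ.+ 1)        ∎
      where
      open ≡-Reasoning
      expand : ∀ m → suc m ℕ.* suc m ≡ m ℕ.* m ℕ.+ (2 ℕ.* m ℕ.+ 1)
      expand = ℕ-Solver.solve-∀
      regroup : ∀ c m → c ℕ.+ m ℕ.+ (2 ℕ.* m ℕ.+ 1) ≡ c ℕ.+ (3 ℕ.* m ℕ.+ 1)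
      regroup = ℕ-Solver.solve-∀

  -- n² = 2·C(n-1,2) + 3(n-1) + 1, and c·(3(n-1)+1) ≤ |↥c|·(3(n-1)+1) ≤ ε·2·C(n-1,2)
  -- as soon as n - 1 > 4·↧ε·|↥c|.
  square≤binomial : ∀ c ε n → 0ℚ < ε → 4 ℕ.* (↧ₙ ε ℕ.* ∣ ↥ c ∣) ℕ.< n ∸ 1 →
    c * ℕtoℚ (n ℕ.* n) ≤ (c + ε) * ℕtoℚ (2 ℕ.* ((n ∸ 1) C 2))
  square≤binomial c ε@(mkℚ (+ zero) _ _)   (suc m) 0<ε _ = ⊥-elim (ℤ.Positive.pos (ℚ.positive 0<ε))
  square≤binomial c ε@(mkℚ -[1+ _ ] _ _) (suc m) 0<ε _ = ⊥-elim (ℤ.Positive.pos (ℚ.positive 0<ε))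
  square≤binomial c ε@(mkℚ +[1+ k ] _ _) (suc m) _ large = begin
    c * ℕtoℚ (suc m ℕ.* suc m)                   ≡⟨ cong (λ x → c * ℕtoℚ x) (square-split m) ⟩
    c * ℕtoℚ (M₂ ℕ.+ (3 ℕ.* m ℕ.+ 1))            ≡⟨ trans (cong (c *_) (ℕtoℚ-+ M₂ _)) (ℚ.*-distribˡ-+ c _ _) ⟩
    c * ℕtoℚ M₂ + c * ℕtoℚ (3 ℕ.* m ℕ.+ 1)
      ≤⟨ ℚ.+-monoʳ-≤ (c * ℕtoℚ M₂)
           (ℚ.*-monoʳ-≤-nonNeg (ℕtoℚ (3 ℕ.* m ℕ.+ 1)) {{ℕtoℚ-nonNeg (3 ℕ.* m ℕ.+ 1)}} (≤-∣numerator∣ c)) ⟩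
    c * ℕtoℚ M₂ + ℕtoℚ K * ℕtoℚ (3 ℕ.* m ℕ.+ 1)   ≡⟨ cong (λ x → c * ℕtoℚ M₂ + x) (ℕtoℚ-* K _) ⟨
    c * ℕtoℚ M₂ + ℕtoℚ (K ℕ.* (3 ℕ.* m ℕ.+ 1))
      ≤⟨ ℚ.+-monoʳ-≤ (c * ℕtoℚ M₂) (ℕ≤*ℕ ε refl (ℕ.≤-trans (ℕ.≤-reflexive (sym (ℕ.*-assoc q K _)))
                                                 (ℕ.≤-trans (linear≤binomial m (q ℕ.* K) large) (ℕ.m≤n*m M₂ (suc k))))) ⟩
    c * ℕtoℚ M₂ + ε * ℕtoℚ M₂                    ≡⟨ ℚ.*-distribʳ-+ (ℕtoℚ M₂) c ε ⟨
    (c + ε) * ℕtoℚ M₂                            ∎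
    where
    open ℚ.≤-Reasoning
    q = ↧ₙ ε
    K = ∣ ↥ c ∣
    M₂ = 2 ℕ.* (m C 2)

  record Construction (ρ c : ℚ) (t : ℕ) : Set where
    field
      graph   : Graphℕ
      d p     : ℕ
      profile : Profile graph d p
      large   : t ℕ.≤ order graph
      dense   : ρ * ℕtoℚ (order graph) ≤ ℕtoℚ d
      sparse  : ℕtoℚ p ≤ c * ℕtoℚ (order graph ℕ.* order graph)

  module _ {ρ c t} (con : Construction ρ c t) where
    open Construction con
    private
      n = order graph
      G = toGraph graph

    construction-edges : 0ℚ ≤ ρ → ρ * ℕtoℚ (n C 2) ≤ ℕtoℚ (edges G)
    construction-edges 0≤ρ = ℚ.*-cancelˡ-≤-pos (ℕtoℚ 2) {{ℕtoℚ-pos 2}} (begin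
      ℕtoℚ 2 * (ρ * ℕtoℚ (n C 2))     ≡⟨ x∙yz≈y∙xz (ℕtoℚ 2) ρ _ ⟩
      ρ * (ℕtoℚ 2 * ℕtoℚ (n C 2))     ≡⟨ cong (ρ *_) (ℕtoℚ-* 2 (n C 2)) ⟨
      ρ * ℕtoℚ (2 ℕ.* (n C 2))
        ≤⟨ ℚ.*-monoˡ-≤-nonNeg ρ {{ℚ.nonNegative 0≤ρ}} (ℕtoℚ-mono-≤ (ℕ.m≤m+n (2 ℕ.* (n C 2)) n)) ⟩
      ρ * ℕtoℚ (2 ℕ.* (n C 2) ℕ.+ n)  ≡⟨ cong (λ m → ρ * ℕtoℚ m) (2*nC2+n≡n*n n) ⟩
      ρ * ℕtoℚ (n ℕ.* n)              ≡⟨ trans (cong (ρ *_) (ℕtoℚ-* n n)) (sym (ℚ.*-assoc ρ _ _)) ⟩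
      ρ * ℕtoℚ n * ℕtoℚ n             ≤⟨ ℚ.*-monoʳ-≤-nonNeg (ℕtoℚ n) {{ℕtoℚ-nonNeg n}} dense ⟩
      ℕtoℚ d * ℕtoℚ n                 ≡⟨ trans (sym (ℕtoℚ-* d n)) (cong ℕtoℚ (ℕ.*-comm d n)) ⟩
      ℕtoℚ (n ℕ.* d)                  ≡⟨ cong ℕtoℚ (trans (sym (∑-degree profile)) (sym (handshake graph))) ⟩
      ℕtoℚ (2 ℕ.* edges G)            ≡⟨ ℕtoℚ-* 2 (edges G) ⟩
      ℕtoℚ 2 * ℕtoℚ (edges G)         ∎)
      where open ℚ.≤-Reasoning

    construction-tmax : ∀ ε → 0ℚ < ε → 4 ℕ.* (↧ₙ ε ℕ.* ∣ ↥ c ∣) ℕ.< n ∸ 1 →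
      ℕtoℚ (tmax G) ≤ (c + ε) * ℕtoℚ ((n ∸ 1) C 2)
    construction-tmax ε 0<ε large = ℚ.*-cancelˡ-≤-pos (ℕtoℚ 2) {{ℕtoℚ-pos 2}} (begin
      ℕtoℚ 2 * ℕtoℚ (tmax G)                 ≡⟨ ℕtoℚ-* 2 (tmax G) ⟨
      ℕtoℚ (2 ℕ.* tmax G)
        ≤⟨ ℕtoℚ-mono-≤ (tmax-≤ G 2 p (λ x → subst (ℕ._≤ p) (sym (triDeg-toGraph graph x)) (ordTriDeg-≤ profile (toℕ<n x)))) ⟩
      ℕtoℚ p                                 ≤⟨ sparse ⟩
      c * ℕtoℚ (n ℕ.* n)                     ≤⟨ square≤binomial c ε n 0<ε large ⟩
      (c + ε) * ℕtoℚ (2 ℕ.* M)               ≡⟨ cong ((c + ε) *_) (ℕtoℚ-* 2 M) ⟩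
      (c + ε) * (ℕtoℚ 2 * ℕtoℚ M)            ≡⟨ x∙yz≈y∙xz (c + ε) (ℕtoℚ 2) (ℕtoℚ M) ⟩
      ℕtoℚ 2 * ((c + ε) * ℕtoℚ M)            ∎)
      where
      open ℚ.≤-Reasoning
      M = (n ∸ 1) C 2

  TauLe-intro : ∀ {ρ c} → 0ℚ ≤ ρ → (∀ t → Construction ρ c t) → TauLe ρ c
  TauLe-intro {ρ} {c} 0≤ρ family ε 0<ε N =
    order graph , N≤n , toGraph graph , construction-edges con 0≤ρ , construction-tmax con ε 0<ε room
    where
    bound = 4 ℕ.* (↧ₙ ε ℕ.* ∣ ↥ c ∣)
    con = family (suc (N ℕ.+ suc bound))
    open Construction con
    N≤n : N ℕ.≤ order graph
    N≤n = ℕ.≤-trans (ℕ.m≤m+n N (suc bound)) (ℕ.≤-trans (ℕ.n≤1+n _) large)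
    room : bound ℕ.< order graph ∸ 1
    room = ℕ.≤-trans (ℕ.m≤n+m (suc bound) N) (ℕ.∸-monoˡ-≤ 1 large)

  private
    ρ*denominator : ∀ ρ {a} → ↥ ρ ≡ + a → ρ * ℕtoℚ (↧ₙ ρ) ≡ ℕtoℚ a
    ρ*denominator ρ ↥ρ≡a = trans (*-denominator ρ) (cong ℤtoℚ ↥ρ≡a)

    ℕtoℚ-*₃ : ∀ x y z → ℕtoℚ (x ℕ.* y ℕ.* z) ≡ ℕtoℚ x * ℕtoℚ y * ℕtoℚ z
    ℕtoℚ-*₃ x y z = trans (ℕtoℚ-* (x ℕ.* y) z) (cong (_* ℕtoℚ z) (ℕtoℚ-* x y))

    constant-cleared : ∀ r′ → let R = ℕtoℚ (suc r′) ; R′ = ℕtoℚ r′ in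
      (+ r′ ℤ.* (+ suc r′ ℤ.- + 2)) / (suc r′ ℕ.* suc r′) * (R * R) + R′ ≡ R′ * R′
    constant-cleared r′ = begin
      i / (suc r′ ℕ.* suc r′) * (R * R) + R′
        ≡⟨ cong (λ x → i / (suc r′ ℕ.* suc r′) * x + R′) (ℕtoℚ-* (suc r′) (suc r′)) ⟨
      i / (suc r′ ℕ.* suc r′) * ℕtoℚ (suc r′ ℕ.* suc r′) + R′
        ≡⟨ cong (_+ R′) (/-*-denominator i (suc r′ ℕ.* suc r′)) ⟩
      ℤtoℚ i + ℤtoℚ (+ r′)                                  ≡⟨ ℤtoℚ-+ i (+ r′) ⟨
      ℤtoℚ (i ℤ.+ + r′)                                     ≡⟨ cong ℤtoℚ (square-minus-self r′) ⟩
      ℤtoℚ (+ r′ ℤ.* + r′)                                  ≡⟨ ℤtoℚ-* (+ r′) (+ r′) ⟩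
      R′ * R′                                               ∎
      where
      open ≡-Reasoning
      R = ℕtoℚ (suc r′)
      R′ = ℕtoℚ r′
      i = + r′ ℤ.* (+ suc r′ ℤ.- + 2)
      square-minus-self : ∀ n → + n ℤ.* (+ suc n ℤ.- + 2) ℤ.+ + n ≡ + n ℤ.* + n
      square-minus-self n = trans (cong (λ s → + n ℤ.* (s ℤ.- + 2) ℤ.+ + n) (ℤ.pos-+ 1 n)) (identity (+ n))
        where
        identity : ∀ m → m ℤ.* (+ 1 ℤ.+ m ℤ.- + 2) ℤ.+ m ≡ m ℤ.* m
        identity = ℤ-Solver.solve-∀

  bound₁-cleared : ∀ r′ ρ {a w} → ↥ ρ ≡ + a → w ℕ.+ r′ ℕ.* ↧ₙ ρ ≡ a ℕ.* suc r′ →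
    bound₁ (suc r′) ρ * ℕtoℚ (suc r′ ℕ.* suc r′ ℕ.* ↧ₙ ρ) + ℕtoℚ (r′ ℕ.* ↧ₙ ρ)
      ≡ ℕtoℚ (r′ ℕ.* r′ ℕ.* ↧ₙ ρ ℕ.+ 3 ℕ.* r′ ℕ.* w)
  bound₁-cleared r′ ρ {a} {w} ↥ρ≡a hw = begin
    (K₁ + K₂ * (ρ - L)) * ℕtoℚ (suc r′ ℕ.* suc r′ ℕ.* b) + ℕtoℚ (r′ ℕ.* b)
      ≡⟨ cong₂ (λ x y → (K₁ + K₂ * (ρ - L)) * x + y) (ℕtoℚ-*₃ (suc r′) (suc r′) b) (ℕtoℚ-* r′ b) ⟩
    (K₁ + K₂ * (ρ - L)) * (R * R * B) + R′ * B
      ≡⟨ expand K₁ K₂ ρ L R B R′ ⟩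
    (K₁ * (R * R) + R′) * B + (K₂ * R) * ((ρ * B) * R - (L * R) * B)
      ≡⟨ cong₂ (λ x y → x * B + y * ((ρ * B) * R - (L * R) * B)) (constant-cleared r′) K₂-cleared ⟩
    (R′ * R′) * B + T * ((ρ * B) * R - (L * R) * B)
      ≡⟨ cong₂ (λ x y → (R′ * R′) * B + T * (x * R - y * B))
               (ρ*denominator ρ ↥ρ≡a) (/-*-denominator (+ r′) (suc r′)) ⟩
    R′ * R′ * B + T * (A * R - R′ * B)
      ≡⟨ cong (λ x → R′ * R′ * B + T * (x - R′ * B)) w-cleared ⟨
    R′ * R′ * B + T * (Wq + R′ * B - R′ * B)
      ≡⟨ cancel (R′ * R′ * B) T Wq (R′ * B) ⟩
    R′ * R′ * B + T * Wq
      ≡⟨ cong₂ _+_ (ℕtoℚ-*₃ r′ r′ b) (ℕtoℚ-* (3 ℕ.* r′) w) ⟨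
    ℕtoℚ (r′ ℕ.* r′ ℕ.* b) + ℕtoℚ (3 ℕ.* r′ ℕ.* w)
      ≡⟨ ℕtoℚ-+ (r′ ℕ.* r′ ℕ.* b) (3 ℕ.* r′ ℕ.* w) ⟨
    ℕtoℚ (r′ ℕ.* r′ ℕ.* b ℕ.+ 3 ℕ.* r′ ℕ.* w) ∎
    where
    open ≡-Reasoning
    b = ↧ₙ ρ
    R = ℕtoℚ (suc r′)
    R′ = ℕtoℚ r′
    B = ℕtoℚ b
    A = ℕtoℚ a
    T = ℕtoℚ (3 ℕ.* r′)
    Wq = ℕtoℚ w
    L = lowerEnd (suc r′)
    K₁ = (+ r′ ℤ.* (+ suc r′ ℤ.- + 2)) / (suc r′ ℕ.* suc r′)
    K₂ = + (3 ℕ.* r′) / suc r′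
    K₂-cleared : K₂ * R ≡ T
    K₂-cleared = /-*-denominator (+ (3 ℕ.* r′)) (suc r′)
    w-cleared : Wq + R′ * B ≡ A * R
    w-cleared = begin
      Wq + R′ * B              ≡⟨ cong (λ x → Wq + x) (ℕtoℚ-* r′ b) ⟨
      Wq + ℕtoℚ (r′ ℕ.* b)     ≡⟨ ℕtoℚ-+ w (r′ ℕ.* b) ⟨
      ℕtoℚ (w ℕ.+ r′ ℕ.* b)    ≡⟨ cong ℕtoℚ hw ⟩
      ℕtoℚ (a ℕ.* suc r′)      ≡⟨ ℕtoℚ-* a (suc r′) ⟩
      A * R                    ∎
    expand : ∀ K₁ K₂ ρ L R B R′ →
      (K₁ + K₂ * (ρ - L)) * (R * R * B) + R′ * B ≡ (K₁ * (R * R) + R′) * B + (K₂ * R) * ((ρ * B) * R - (L * R) * B)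
    expand = solve 7 (λ K₁ K₂ ρ L R B R′ → (K₁ :+ K₂ :* (ρ :- L)) :* (R :* R :* B) :+ R′ :* B
                                         := (K₁ :* (R :* R) :+ R′) :* B :+ (K₂ :* R) :* ((ρ :* B) :* R :- (L :* R) :* B)) refl
    cancel : ∀ X T W Y → X + T * (W + Y - Y) ≡ X + T * W
    cancel = solve 4 (λ X T W Y → X :+ T :* (W :+ Y :- Y) := X :+ T :* W) refl

  bound₂-cleared : ∀ r′ ρ {a v} → ↥ ρ ≡ + a → a ℕ.* suc (suc r′) ℕ.+ v ≡ suc r′ ℕ.* ↧ₙ ρ →
    bound₂ (suc r′) ρ * ℕtoℚ (suc (suc r′) ℕ.* suc (suc r′) ℕ.* ↧ₙ ρ) + ℕtoℚ (3 ℕ.* r′ ℕ.* v)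
      ≡ ℕtoℚ (suc r′ ℕ.* r′ ℕ.* ↧ₙ ρ)
  bound₂-cleared r′ ρ {a} {v} ↥ρ≡a hv = begin
    (K₁ - K₂ * (U - ρ)) * ℕtoℚ (suc (suc r′) ℕ.* suc (suc r′) ℕ.* b) + ℕtoℚ (3 ℕ.* r′ ℕ.* v)
      ≡⟨ cong₂ (λ x y → (K₁ - K₂ * (U - ρ)) * x + y)
               (ℕtoℚ-*₃ (suc (suc r′)) (suc (suc r′)) b) (ℕtoℚ-* (3 ℕ.* r′) v) ⟩
    (K₁ - K₂ * (U - ρ)) * (R₁ * R₁ * B) + T * V
      ≡⟨ cong (λ y → (K₁ - K₂ * (U - ρ)) * (R₁ * R₁ * B) + y * V) K₂-cleared ⟨
    (K₁ - K₂ * (U - ρ)) * (R₁ * R₁ * B) + (K₂ * R₁) * V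
      ≡⟨ expand K₁ K₂ U ρ R₁ B V ⟩
    (K₁ * (R₁ * R₁)) * B - (K₂ * R₁) * ((U * R₁) * B - ((ρ * B) * R₁ + V))
      ≡⟨ cong₂ (λ x y → x * B - y * ((U * R₁) * B - ((ρ * B) * R₁ + V))) K₁-cleared K₂-cleared ⟩
    X * B - T * ((U * R₁) * B - ((ρ * B) * R₁ + V))
      ≡⟨ cong₂ (λ x y → X * B - T * (x * B - (y * R₁ + V)))
               (/-*-denominator (+ suc r′) (suc (suc r′))) (ρ*denominator ρ ↥ρ≡a) ⟩
    X * B - T * (R * B - (A * R₁ + V))
      ≡⟨ cong (λ x → X * B - T * (R * B - x)) v-cleared ⟩
    X * B - T * (R * B - R * B)
      ≡⟨ cancel (X * B) T (R * B) ⟩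
    X * B
      ≡⟨ ℕtoℚ-* (suc r′ ℕ.* r′) b ⟨
    ℕtoℚ (suc r′ ℕ.* r′ ℕ.* b) ∎
    where
    open ≡-Reasoning
    b = ↧ₙ ρ
    R = ℕtoℚ (suc r′)
    R₁ = ℕtoℚ (suc (suc r′))
    B = ℕtoℚ b
    A = ℕtoℚ a
    V = ℕtoℚ v
    T = ℕtoℚ (3 ℕ.* r′)
    X = ℕtoℚ (suc r′ ℕ.* r′)
    U = upperEnd (suc r′)
    K₁ = + (suc r′ ℕ.* r′) / (suc (suc r′) ℕ.* suc (suc r′))
    K₂ = + (3 ℕ.* r′) / suc (suc r′)
    K₁-cleared : K₁ * (R₁ * R₁) ≡ X
    K₁-cleared = trans (cong (K₁ *_) (sym (ℕtoℚ-* (suc (suc r′)) (suc (suc r′)))))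
                       (/-*-denominator (+ (suc r′ ℕ.* r′)) (suc (suc r′) ℕ.* suc (suc r′)))
    v-cleared : A * R₁ + V ≡ R * B
    v-cleared = begin
      A * R₁ + V                        ≡⟨ cong (_+ V) (ℕtoℚ-* a (suc (suc r′))) ⟨
      ℕtoℚ (a ℕ.* suc (suc r′)) + V     ≡⟨ ℕtoℚ-+ (a ℕ.* suc (suc r′)) v ⟨
      ℕtoℚ (a ℕ.* suc (suc r′) ℕ.+ v)   ≡⟨ cong ℕtoℚ hv ⟩
      ℕtoℚ (suc r′ ℕ.* b)               ≡⟨ ℕtoℚ-* (suc r′) b ⟩
      R * B                             ∎
    K₂-cleared : K₂ * R₁ ≡ T
    K₂-cleared = /-*-denominator (+ (3 ℕ.* r′)) (suc (suc r′))
    expand : ∀ K₁ K₂ U ρ R₁ B V → (K₁ - K₂ * (U - ρ)) * (R₁ * R₁ * B) + (K₂ * R₁) * V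
                                 ≡ (K₁ * (R₁ * R₁)) * B - (K₂ * R₁) * ((U * R₁) * B - ((ρ * B) * R₁ + V))
    expand = solve 7 (λ K₁ K₂ U ρ R₁ B V → (K₁ :- K₂ :* (U :- ρ)) :* (R₁ :* R₁ :* B) :+ (K₂ :* R₁) :* V
                                         := (K₁ :* (R₁ :* R₁)) :* B :- (K₂ :* R₁) :* ((U :* R₁) :* B :- ((ρ :* B) :* R₁ :+ V))) refl
    cancel : ∀ X T Y → X - T * (Y - Y) ≡ X
    cancel = solve 3 (λ X T Y → X :- T :* (Y :- Y) := X) refl

  0≤lowerEnd : ∀ r′ → ℚ.0ℚ ≤ lowerEnd (suc r′)
  0≤lowerEnd r′ = ℚ.nonNegative⁻¹ (lowerEnd (suc r′)) {{ℚ.normalize-nonNeg r′ (suc r′)}}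

  lowerEnd≤⇒ : ∀ r′ ρ → lowerEnd (suc r′) ≤ ρ → ∃[ a ] (↥ ρ ≡ + a × r′ ℕ.* ↧ₙ ρ ℕ.≤ a ℕ.* suc r′)
  lowerEnd≤⇒ r′ ρ L≤ρ with nonNeg-numerator (ℚ.≤-trans (0≤lowerEnd r′) L≤ρ)
  ... | a , ↥ρ≡a = a , ↥ρ≡a , frac≤⇒ r′ r′ L≤ρ ↥ρ≡a

  ≤upperEnd⇒ : ∀ r′ ρ {a} → ↥ ρ ≡ + a → ρ ≤ upperEnd (suc r′) → a ℕ.* suc (suc r′) ℕ.≤ suc r′ ℕ.* ↧ₙ ρ
  ≤upperEnd⇒ r′ ρ ↥ρ≡a ρ≤U = ≤frac⇒ (suc r′) (suc r′) ρ≤U ↥ρ≡a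

  private
    breakPt≤-cleared : ∀ r′ ρ {a} → let r = suc r′ in ↥ ρ ≡ + a → breakPt r ≤ ρ →
      r ℕ.* (↧ₙ ρ ℕ.* (3 ℕ.* r ℕ.* suc r)) ℕ.≤ a ℕ.* (suc r ℕ.* (3 ℕ.* r ℕ.* suc r)) ℕ.+ suc r ℕ.* ↧ₙ ρ
    breakPt≤-cleared r′ ρ {a} ↥ρ≡a bp≤ρ = ℕtoℚ-cancel-≤ (begin
      ℕtoℚ (r ℕ.* (b ℕ.* M))
        ≡⟨ trans (ℕtoℚ-* r (b ℕ.* M)) (cong₂ _*_ (sym (/-*-denominator (+ r) (suc r))) (ℕtoℚ-* b M)) ⟩
      U * R₁ * (B * M′)
        ≡⟨ ℚ.*-assoc U R₁ (B * M′) ⟩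
      U * (R₁ * (B * M′))
        ≤⟨ ℚ.*-monoʳ-≤-nonNeg (R₁ * (B * M′)) {{nonNeg}} U≤ρ+δ ⟩
      (ρ + δ) * (R₁ * (B * M′))
        ≡⟨ regroup ρ δ R₁ B M′ ⟩
      (ρ * B) * (R₁ * M′) + (δ * M′) * (R₁ * B)
        ≡⟨ cong₂ (λ x y → x * (R₁ * M′) + y * (R₁ * B)) (ρ*denominator ρ ↥ρ≡a) (/-*-denominator (+ 1) M) ⟩
      ℕtoℚ a * (R₁ * M′) + ℚ.1ℚ * (R₁ * B)
        ≡⟨ cong₂ _+_ (trans (cong (ℕtoℚ a *_) (sym (ℕtoℚ-* (suc r) M))) (sym (ℕtoℚ-* a (suc r ℕ.* M))))
                     (trans (ℚ.*-identityˡ (R₁ * B)) (sym (ℕtoℚ-* (suc r) b))) ⟩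
      ℕtoℚ (a ℕ.* (suc r ℕ.* M)) + ℕtoℚ (suc r ℕ.* b)
        ≡⟨ ℕtoℚ-+ (a ℕ.* (suc r ℕ.* M)) (suc r ℕ.* b) ⟨
      ℕtoℚ (a ℕ.* (suc r ℕ.* M) ℕ.+ suc r ℕ.* b) ∎)
      where
      open ℚ.≤-Reasoning
      r = suc r′
      b = ↧ₙ ρ
      M = 3 ℕ.* r ℕ.* suc r
      δ = + 1 / M
      U = upperEnd r
      R₁ = ℕtoℚ (suc r)
      B = ℕtoℚ b
      M′ = ℕtoℚ M
      nonNeg : ℚ.NonNegative (R₁ * (B * M′))
      nonNeg rewrite sym (ℕtoℚ-* b M) | sym (ℕtoℚ-* (suc r) (b ℕ.* M)) = ℕtoℚ-nonNeg (suc r ℕ.* (b ℕ.* M))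
      U≤ρ+δ : U ≤ ρ + δ
      U≤ρ+δ = ℚ.≤-trans (ℚ.≤-reflexive (sym (minus-plus U δ))) (ℚ.+-monoˡ-≤ δ bp≤ρ)
        where
        minus-plus : ∀ x y → x - y + y ≡ x
        minus-plus = solve 2 (λ x y → x :- y :+ y := x) refl
      regroup : ∀ ρ δ R B M → (ρ + δ) * (R * (B * M)) ≡ (ρ * B) * (R * M) + (δ * M) * (R * B)
      regroup = solve 5 (λ ρ δ R B M → (ρ :+ δ) :* (R :* (B :* M)) := (ρ :* B) :* (R :* M) :+ (δ :* M) :* (R :* B)) refl

  breakPt≤⇒ : ∀ r′ ρ {a v} → ↥ ρ ≡ + a → a ℕ.* suc (suc r′) ℕ.+ v ≡ suc r′ ℕ.* ↧ₙ ρ →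
    breakPt (suc r′) ≤ ρ → 3 ℕ.* suc r′ ℕ.* v ℕ.≤ ↧ₙ ρ
  breakPt≤⇒ r′ ρ {a} {v} ↥ρ≡a hv bp≤ρ = ℕ.*-cancelˡ-≤ (suc r) (begin
    suc r ℕ.* (3 ℕ.* r ℕ.* v)                   ≡⟨ reorder r v ⟩
    v ℕ.* M                                     ≤⟨ ℕ.+-cancelˡ-≤ (a ℕ.* (suc r ℕ.* M)) _ _ (begin
      a ℕ.* (suc r ℕ.* M) ℕ.+ v ℕ.* M             ≡⟨ distrib a (suc r) v M ⟩
      (a ℕ.* suc r ℕ.+ v) ℕ.* M                   ≡⟨ cong (ℕ._* M) hv ⟩
      r ℕ.* b ℕ.* M                               ≡⟨ ℕ.*-assoc r b M ⟩
      r ℕ.* (b ℕ.* M)                             ≤⟨ breakPt≤-cleared r′ ρ ↥ρ≡a bp≤ρ ⟩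
      a ℕ.* (suc r ℕ.* M) ℕ.+ suc r ℕ.* b         ∎) ⟩
    suc r ℕ.* b                                 ∎)
    where
    open ℕ.≤-Reasoning
    r = suc r′
    b = ↧ₙ ρ
    M = 3 ℕ.* r ℕ.* suc r
    reorder : ∀ r v → suc r ℕ.* (3 ℕ.* r ℕ.* v) ≡ v ℕ.* (3 ℕ.* r ℕ.* suc r)
    reorder = ℕ-Solver.solve-∀
    distrib : ∀ a s v M → a ℕ.* (s ℕ.* M) ℕ.+ v ℕ.* M ≡ (a ℕ.* s ℕ.+ v) ℕ.* M
    distrib = ℕ-Solver.solve-∀

module Constructions where

  open import Data.List using ([]; _∷_)
  open import Data.Nat using (ℕ; zero; suc; _+_; _*_; _∸_; _≤_; z≤n; s≤s; NonZero)
  import Data.Nat.Properties as ℕ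
  open import Data.Nat.Tactic.RingSolver using (solve-∀; solve)
  import Data.Integer as ℤ
  open import Data.Rational as ℚ using (ℚ; ↥_; ↧ₙ_)
  open import Data.Product using (∃-syntax; _×_; _,_; proj₁; proj₂)
  open import Data.Sum using (_⊎_; inj₁; inj₂)
  open import Relation.Binary.PropositionalEquality
  open import Defs using (ℕtoℚ; lowerEnd; upperEnd; breakPt; bound₁; bound₂)
  open Counting
  open Densities

  mkConstruction : ∀ {ρ c t a G d p} W Z X .{{_ : NonZero W}} → ↥ ρ ≡ ℤ.+ a → Profile G d p → t ≤ order G →
    a * order G ≡ ↧ₙ ρ * d →
    c ℚ.* ℕtoℚ W ℚ.+ ℕtoℚ Z ≡ ℕtoℚ X → p * W + Z * (order G * order G) ≡ X * (order G * order G) →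
    Construction ρ c t
  mkConstruction {ρ} {c} {a = a} {G} {d} {p} W Z X ↥ρ≡a profile large density cleared triangles = record
    { graph   = G
    ; d       = d
    ; p       = p
    ; profile = profile
    ; large   = large
    ; dense   = *ℕ≤ℕ ρ {a} {d} {order G} ↥ρ≡a (ℕ.≤-reflexive density)
    ; sparse  = ≤-from-cleared c {W} {Z} {X} {p} {order G * order G} cleared (ℕ.≤-reflexive triangles)
    }

  scaled-≤ : ∀ t b k {m n} .{{_ : NonZero b}} .{{_ : NonZero k}} → n ≡ k * (b * suc t) + m → t ≤ n
  scaled-≤ t b k {m} n≡ = ℕ.≤-trans (ℕ.n≤1+n t) (ℕ.≤-trans (ℕ.m≤n*m (suc t) b) (ℕ.≤-trans (ℕ.m≤n*m (b * suc t) k)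
                            (ℕ.≤-trans (ℕ.m≤m+n _ m) (ℕ.≤-reflexive (sym n≡)))))

  private
    cancel-deficit : ∀ {p k q w y z} → p + k ≡ q → q * w + y ≡ z + k * w → p * w + y ≡ z
    cancel-deficit {p} {k} {q} {w} {y} {z} p+k≡q eq = ℕ.+-cancelʳ-≡ (k * w) _ _ (begin
      p * w + y + k * w     ≡⟨ solve (p ∷ k ∷ w ∷ y ∷ []) ⟩
      (p + k) * w + y       ≡⟨ cong (λ x → x * w + y) p+k≡q ⟩
      q * w + y             ≡⟨ eq ⟩
      z + k * w             ∎)
      where open ≡-Reasoning

  slack-bound : ∀ r′ {a b w} → w + r′ * b ≡ a * suc r′ → a * suc (suc r′) ≤ suc r′ * b → 2 * w ≤ b
  slack-bound r′ {a} {b} {w} hw upper = ℕ.≤-trans (ℕ.*-monoˡ-≤ w (s≤s (s≤s (z≤n {r′}))))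
    (ℕ.+-cancelʳ-≤ (suc (suc r′) * (r′ * b)) (suc (suc r′) * w) b (begin
      suc (suc r′) * w + suc (suc r′) * (r′ * b)   ≡⟨ ℕ.*-distribˡ-+ (suc (suc r′)) w (r′ * b) ⟨
      suc (suc r′) * (w + r′ * b)                 ≡⟨ cong (suc (suc r′) *_) hw ⟩
      suc (suc r′) * (a * suc r′)                 ≡⟨ solve (r′ ∷ a ∷ []) ⟩
      suc r′ * (a * suc (suc r′))                 ≤⟨ ℕ.*-monoʳ-≤ (suc r′) upper ⟩
      suc r′ * (suc r′ * b)                       ≡⟨ solve (r′ ∷ b ∷ []) ⟩
      b + suc (suc r′) * (r′ * b)                 ∎))
    where open ℕ.≤-Reasoning

  -- With r = suc r′ and ρ = a/b:  ρ = (r-1)/r + w/(rb) = r/(r+1) - v/((r+1)b).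
  module Interval (r′ : ℕ) (ρ : ℚ) (L≤ρ : lowerEnd (suc r′) ℚ.≤ ρ) (ρ≤U : ρ ℚ.≤ upperEnd (suc r′)) where

    a = proj₁ (lowerEnd≤⇒ r′ ρ L≤ρ)
    ↥ρ≡a = proj₁ (proj₂ (lowerEnd≤⇒ r′ ρ L≤ρ))
    b = ↧ₙ ρ
    lower = proj₂ (proj₂ (lowerEnd≤⇒ r′ ρ L≤ρ))
    upper = ≤upperEnd⇒ r′ ρ ↥ρ≡a ρ≤U

    w = a * suc r′ ∸ r′ * b
    v = suc r′ * b ∸ a * suc (suc r′)

    hw : w + r′ * b ≡ a * suc r′
    hw = ℕ.m∸n+n≡m lower

    hv : a * suc (suc r′) + v ≡ suc r′ * b
    hv = ℕ.m+[n∸m]≡n upper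

    2w≤b : 2 * w ≤ b
    2w≤b = slack-bound r′ {a} hw upper

    v≤b : v ≤ b
    v≤b = ℕ.+-cancelˡ-≤ (a * suc (suc r′)) v b (begin
      a * suc (suc r′) + v        ≡⟨ hv ⟩
      b + r′ * b                  ≤⟨ ℕ.+-monoʳ-≤ b (ℕ.≤-trans lower (ℕ.*-monoʳ-≤ a (ℕ.n≤1+n (suc r′)))) ⟩
      b + a * suc (suc r′)        ≡⟨ ℕ.+-comm b _ ⟩
      a * suc (suc r′) + b        ∎)
      where open ℕ.≤-Reasoning

  bound₁-density : ∀ r′ {a b w} T {n d} → w + r′ * b ≡ a * suc r′ →
    n ≡ 2 * (b * T) + r′ * (2 * (b * T)) → d ≡ 2 * w * T + r′ * (2 * (b * T)) → a * n ≡ b * d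
  bound₁-density r′ {a} {b} {w} T hw refl refl = begin
    a * (2 * (b * T) + r′ * (2 * (b * T)))    ≡⟨ solve (r′ ∷ a ∷ b ∷ T ∷ []) ⟩
    2 * b * T * (a * suc r′)                  ≡⟨ cong (2 * b * T *_) hw ⟨
    2 * b * T * (w + r′ * b)                  ≡⟨ solve (r′ ∷ b ∷ T ∷ w ∷ []) ⟩
    b * (2 * w * T + r′ * (2 * (b * T)))      ∎
    where open ≡-Reasoning

  bound₁-triangles : ∀ r′ b T w {n p} → n ≡ 2 * (b * T) + r′ * (2 * (b * T)) →
    p + r′ * (2 * (b * T) * (2 * (b * T)))
      ≡ 0 + r′ * (2 * (b * T) * (2 * w * T)) + 2 * (r′ * (2 * (b * T) * (2 * w * T))) + r′ * (2 * (b * T)) * (r′ * (2 * (b * T))) →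
    p * (suc r′ * suc r′ * b) + r′ * b * (n * n) ≡ (r′ * r′ * b + 3 * r′ * w) * (n * n)
  bound₁-triangles r′ b T w {p = p} refl closed =
    cancel-deficit {p} {r′ * (2 * (b * T) * (2 * (b * T)))} closed (solve (r′ ∷ b ∷ T ∷ w ∷ []))

  bound₁-construction : ∀ r′ ρ → lowerEnd (suc r′) ℚ.≤ ρ → ρ ℚ.≤ upperEnd (suc r′) →
    ∀ t → Construction ρ (bound₁ (suc r′) ρ) t
  bound₁-construction r′ ρ L≤ρ ρ≤U t =
    mkConstruction (suc r′ * suc r′ * b) (r′ * b) (r′ * r′ * b + 3 * r′ * w) ↥ρ≡a (proj₁ (joins-profile r′))
      (scaled-≤ t b 2 (order-joins r′)) (bound₁-density r′ {a} T hw (order-joins r′) (D-closed r′))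
      (bound₁-cleared r′ ρ ↥ρ≡a hw) (bound₁-triangles r′ b T w (order-joins r′) (P-closed r′))
    where
    open Interval r′ ρ L≤ρ ρ≤U
    T = suc t
    e≤s : 2 * w * T ≤ b * T
    e≤s = ℕ.*-monoˡ-≤ T 2w≤b
    open BlowUp (b * T) (2 * w * T) e≤s using (blowUp)
    open Gadgets (b * T) (2 * w * T) e≤s using (bipartite-profile)
    open SelfJoins bipartite-profile

  bound₂-odd-density : ∀ j {a b} u v T {n d} → a * suc (suc (2 * j)) + v ≡ suc (2 * j) * b → u + v ≡ b →
    n ≡ 2 * (b * T) + j * (2 * (b * T)) → d ≡ u * T + j * (2 * (b * T)) → a * n ≡ b * d
  bound₂-odd-density j {a} {b} u v T hv hu refl refl = ℕ.+-cancelʳ-≡ (v * (b * T)) _ _ (begin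
    a * (2 * (b * T) + j * (2 * (b * T))) + v * (b * T)   ≡⟨ solve (j ∷ a ∷ b ∷ v ∷ T ∷ []) ⟩
    b * T * (a * suc (suc (2 * j)) + v)                   ≡⟨ cong (b * T *_) hv ⟩
    b * T * (suc (2 * j) * b)                             ≡⟨ solve (j ∷ b ∷ T ∷ []) ⟩
    b * T * (b + 2 * j * b)                               ≡⟨ cong (λ x → b * T * (x + 2 * j * b)) hu ⟨
    b * T * (u + v + 2 * j * b)                           ≡⟨ solve (j ∷ b ∷ u ∷ v ∷ T ∷ []) ⟩
    b * (u * T + j * (2 * (b * T))) + v * (b * T)         ∎)
    where open ≡-Reasoning

  bound₂-odd-triangles : ∀ j u v T {b n p} → u + v ≡ b → n ≡ 2 * (b * T) + j * (2 * (b * T)) →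
    p + j * (2 * (b * T) * (2 * (b * T)))
      ≡ 0 + j * (2 * (b * T) * (u * T)) + 2 * (j * (2 * (b * T) * (u * T))) + j * (2 * (b * T)) * (j * (2 * (b * T))) →
    p * (suc (suc (2 * j)) * suc (suc (2 * j)) * b) + 3 * (2 * j) * v * (n * n) ≡ suc (2 * j) * (2 * j) * b * (n * n)
  bound₂-odd-triangles j u v T {p = p} refl refl closed =
    cancel-deficit {p} {j * (2 * ((u + v) * T) * (2 * ((u + v) * T)))} closed (solve (j ∷ u ∷ v ∷ T ∷ []))

  bound₂-construction-odd : ∀ j ρ → let r′ = 2 * j in
    lowerEnd (suc r′) ℚ.≤ ρ → ρ ℚ.≤ upperEnd (suc r′) → ∀ t → Construction ρ (bound₂ (suc r′) ρ) t
  bound₂-construction-odd j ρ L≤ρ ρ≤U t =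
    mkConstruction (suc (suc r′) * suc (suc r′) * b) (3 * r′ * v) (suc r′ * r′ * b) ↥ρ≡a (proj₁ (joins-profile j))
      (scaled-≤ t b 2 (order-joins j)) (bound₂-odd-density j {a} u v T hv hu (order-joins j) (D-closed j))
      (bound₂-cleared r′ ρ ↥ρ≡a hv) (bound₂-odd-triangles j u v T hu (order-joins j) (P-closed j))
    where
    r′ = 2 * j
    open Interval r′ ρ L≤ρ ρ≤U
    u = b ∸ v
    hu : u + v ≡ b
    hu = ℕ.m∸n+n≡m v≤b
    T = suc t
    f≤s : u * T ≤ b * T
    f≤s = ℕ.*-monoˡ-≤ T (ℕ.m∸n≤m b v)
    open BlowUp (b * T) (u * T) f≤s using (blowUp)
    open Gadgets (b * T) (u * T) f≤s using (bipartite-profile)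
    open SelfJoins bipartite-profile

  bound₂-even-density : ∀ j {a b} u v T {n d} → a * suc (suc (suc (2 * j))) + v ≡ suc (suc (2 * j)) * b → u + 2 * v ≡ b →
    n ≡ 6 * (b * T) + j * (2 * (2 * (b * T))) → d ≡ 3 * (b * T) + 1 * (u * T) + j * (2 * (2 * (b * T))) → a * n ≡ b * d
  bound₂-even-density j {a} {b} u v T hv hu refl refl = ℕ.+-cancelʳ-≡ (v * (2 * (b * T))) _ _ (begin
    a * (6 * (b * T) + j * (2 * (2 * (b * T)))) + v * (2 * (b * T))   ≡⟨ solve (j ∷ a ∷ b ∷ v ∷ T ∷ []) ⟩
    2 * (b * T) * (a * suc (suc (suc (2 * j))) + v)                   ≡⟨ cong (2 * (b * T) *_) hv ⟩
    2 * (b * T) * (suc (suc (2 * j)) * b)                             ≡⟨ solve (j ∷ b ∷ T ∷ []) ⟩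
    b * T * (3 * b + b + 4 * j * b)                                   ≡⟨ cong (λ x → b * T * (3 * b + x + 4 * j * b)) hu ⟨
    b * T * (3 * b + (u + 2 * v) + 4 * j * b)                         ≡⟨ solve (j ∷ b ∷ u ∷ v ∷ T ∷ []) ⟩
    b * (3 * (b * T) + 1 * (u * T) + j * (2 * (2 * (b * T)))) + v * (2 * (b * T)) ∎)
    where open ≡-Reasoning

  bound₂-even-triangles : ∀ j u v T {b n p} → u + 2 * v ≡ b → n ≡ 6 * (b * T) + j * (2 * (2 * (b * T))) →
    let h = b * T ; e = u * T in
    p + j * (2 * (2 * h) * (2 * (2 * h)))
      ≡ h * (2 * h + 6 * e) + j * (2 * (2 * h) * (h + e)) + 2 * (j * (2 * (2 * h) * (3 * h + 1 * e))) + j * (2 * (2 * h)) * (j * (2 * (2 * h))) →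
    p * (suc (suc (suc (2 * j))) * suc (suc (suc (2 * j))) * b) + 3 * suc (2 * j) * v * (n * n) ≡ suc (suc (2 * j)) * suc (2 * j) * b * (n * n)
  bound₂-even-triangles j u v T {p = p} refl refl closed =
    cancel-deficit {p} {j * (2 * (2 * ((u + 2 * v) * T)) * (2 * (2 * ((u + 2 * v) * T))))} closed (solve (j ∷ u ∷ v ∷ T ∷ []))

  private
    hexagon-co-degree : ∀ h e → h + e + 6 * h ≡ 2 * (2 * h) + (3 * h + 1 * e)
    hexagon-co-degree = solve-∀

    hexagon-base : ∀ h e → 2 * (6 * h * (h + e)) + 6 * h * (3 * h + 1 * e)
                         ≡ 2 * (2 * h) * (h + e) + 2 * (2 * (2 * h) * (3 * h + 1 * e)) + h * (2 * h + 6 * e)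
    hexagon-base = solve-∀

  bound₂-construction-even : ∀ j ρ → let r′ = suc (2 * j) in
    lowerEnd (suc r′) ℚ.≤ ρ → ρ ℚ.≤ upperEnd (suc r′) → breakPt (suc r′) ℚ.≤ ρ →
    ∀ t → Construction ρ (bound₂ (suc r′) ρ) t
  bound₂-construction-even j ρ L≤ρ ρ≤U bp≤ρ t =
    mkConstruction (suc (suc r′) * suc (suc r′) * b) (3 * r′ * v) (suc r′ * r′ * b) ↥ρ≡a (proj₁ (joins-profile j))
      (scaled-≤ t b 6 (order-joins j)) (bound₂-even-density j {a} u v T hv hu (order-joins j) (D-closed j))
      (bound₂-cleared r′ ρ ↥ρ≡a hv) (bound₂-even-triangles j u v T hu (order-joins j) (P-closed j))
    where
    r′ = suc (2 * j)
    open Interval r′ ρ L≤ρ ρ≤U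
    -- The only use of breakPt r ≤ ρ: it gives 2v ≤ b, so that u = b ∸ 2v is not truncated.
    2v≤b : 2 * v ≤ b
    2v≤b = ℕ.≤-trans (ℕ.*-monoˡ-≤ v (ℕ.≤-trans (ℕ.n≤1+n 2) (ℕ.m≤m*n 3 (suc r′))))
                     (breakPt≤⇒ r′ ρ ↥ρ≡a hv bp≤ρ)
    u = b ∸ 2 * v
    hu : u + 2 * v ≡ b
    hu = ℕ.m∸n+n≡m 2v≤b
    T = suc t
    h = b * T
    e = u * T
    e≤h : e ≤ h
    e≤h = ℕ.*-monoˡ-≤ T (ℕ.m∸n≤m b (2 * v))
    h+e≤2h : h + e ≤ 2 * h
    h+e≤2h = ℕ.≤-trans (ℕ.+-monoʳ-≤ h e≤h) (ℕ.≤-reflexive (cong (h +_) (sym (ℕ.+-identityʳ h))))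
    open Gadgets h e e≤h using (hexagon-profile)
    open Gadgets (2 * h) (h + e) h+e≤2h using (bipartite-profile)
    open Joins bipartite-profile hexagon-profile (hexagon-co-degree h e) (ℕ.≤-reflexive (hexagon-base h e))

  private
    even-or-odd : ∀ n → (∃[ j ] n ≡ 2 * j) ⊎ (∃[ j ] n ≡ suc (2 * j))
    even-or-odd zero    = inj₁ (0 , refl)
    even-or-odd (suc n) with even-or-odd n
    ... | inj₁ (j , refl) = inj₂ (j , refl)
    ... | inj₂ (j , refl) = inj₁ (suc j , cong suc (sym (ℕ.+-suc j (j + 0))))

  bound₂-construction : ∀ r′ ρ → lowerEnd (suc r′) ℚ.≤ ρ → ρ ℚ.≤ upperEnd (suc r′) → breakPt (suc r′) ℚ.≤ ρ →
    ∀ t → Construction ρ (bound₂ (suc r′) ρ) t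
  bound₂-construction r′ ρ L≤ρ ρ≤U bp≤ρ with even-or-odd r′
  ... | inj₁ (j , refl) = bound₂-construction-odd j ρ L≤ρ ρ≤U
  ... | inj₂ (j , refl) = bound₂-construction-even j ρ L≤ρ ρ≤U bp≤ρ

open Densities using (TauLe-intro; 0≤lowerEnd)
open Constructions using (bound₁-construction; bound₂-construction)

open import Defs
open import Data.Nat using (ℕ; NonZero; suc)
open import Data.Rational using (ℚ; _≤_)
open import Data.Rational.Properties using (≤-trans)
open import Data.Product using (_×_; _,_)

theorem1p4 : (r : ℕ) → .{{_ : NonZero r}} → (ρ : ℚ) →
    lowerEnd r ≤ ρ → ρ ≤ upperEnd r →
    (ρ ≤ breakPt r → TauLe ρ (bound₁ r ρ)) ×
    (breakPt r ≤ ρ → TauLe ρ (bound₂ r ρ))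
-- bound₁-construction works on the whole interval.
theorem1p4 (suc r′) ρ L≤ρ ρ≤U =
  (λ _ → TauLe-intro 0≤ρ (bound₁-construction r′ ρ L≤ρ ρ≤U)) ,
  (λ bp≤ρ → TauLe-intro 0≤ρ (bound₂-construction r′ ρ L≤ρ ρ≤U bp≤ρ))
  where
  0≤ρ = ≤-trans (0≤lowerEnd r′) L≤ρ
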